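{- Let $M$ be a closed term. For each $k\in\mathbb{N}$ there exists a tight derivation of $\vdash^{w}M:\mathtt{a}$ such that $\|\mathtt{a}\|=\mathcal{P}_k(M)$ and $w\ge\mathcal{E}_k(M)$.
   Context: Terms: values $V ::= x \mid \lambda x.M$; terms $M ::= V \mid VV \mid M\oplus M \mid \mathtt{let}\ x = M\ \mathtt{in}\ M$; $M\{V/x\}$ is capture-avoiding substitution. A multidistribution on terms is a finite multiset $\langle p_iM_i\rangle_{i\in I}$ with $p_i\in(0,1]$, $\sum_ip_i\le1$; $\sqcup$ is multiset union and $q\cdot\langle p_iM_i\rangle=\langle (qp_i)M_i\rangle$. One-step reduction: $(\lambda x.M)V\to\langle 1\,M\{V/x\}\rangle$; $\mathtt{let}\ x=V\ \mathtt{in}\ M\to\langle 1\,M\{V/x\}\rangle$; $M\oplus N\to\langle\tfrac12 M,\tfrac12 N\rangle$; if $N\to\langle p_iN_i\rangle_{i\in I}$ then $\mathtt{let}\ x=N\ \mathtt{in}\ M\to\langle p_i(\mathtt{let}\ x=N_i\ \mathtt{in}\ M)\rangle_{i\in I}$. Lifting to multidistributions of closed terms: $\langle p_iM_i\rangle_{i\in I}\Rightarrow\bigsqcup_i p_i\cdot\mathbf{m}_i$ where $\mathbf{m}_i=\langle 1M_i\rangle$ if $M_i$ is a value and $M_i\to\mathbf{m}_i$ otherwise. For closed $M$ let $\langle 1M\rangle=\mathbf{m}_0\Rightarrow\mathbf{m}_1\Rightarrow\cdots$; $\mathcal{P}_k(M)$ is the sum of the probabilities of the values occurring in $\mathbf{m}_k$,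 and $\mathcal{E}_k(M)=\sum_{j=0}^{k-1}(1-\mathcal{P}_j(M))$. Types: arrow types $\mathtt{A} ::= \mathcal{M}\to \mathtt{a}$; intersection types $\mathcal{M} ::= [q_1\cdot \mathtt{A}_1,\dots,q_n\cdot\mathtt{A}_n]$ ($n\ge0$, scale factors $q_i\in(0,1]\cap\mathbb{Q}$); type distributions $\mathtt{a} ::= \langle p_1\mathcal{M}_1,\dots,p_n\mathcal{M}_n\rangle$ ($n\ge0$, $p_i\in(0,1]$, $\sum p_i\le1$), with norm $\|\mathtt{a}\|=\sum_i p_i$; $\mathbf{0}$ is the empty type distribution. Scaling: $u\cdot[q_i\cdot\mathtt{A}_i]_i=[(uq_i)\cdot \mathtt{A}_i]_i$, $u\cdot\langle p_i\mathcal{M}_i\rangle_i=\langle (up_i)\mathcal{M}_i\rangle_i$; $\uplus,\sqcup$ multiset unions. Typing contexts map variables to intersection types (finitely many nonempty), pointwise $\uplus$ and scaling. Rules for $\Gamma\vdash^{w}M:\tau$ ($w\in\mathbb{Q}$): (Var) $x:\mathcal{M}\vdash^0 x:\mathcal{M}$. (Zero) $\vdash^0 M:\mathbf{0}$. (@) from $\Gamma\vdash^{w}V:[1\cdot(\mathcal{M}\to\mathtt{b})]$, $\Delta\vdash^{v}W:\mathcal{M}$ infer $\Gamma\uplus\Delta\vdash^{w+v}VW:\mathtt{b}$. ($\oplus$) from $\Gamma\vdash^{w}M:\mathtt{a}$, $\Delta\vdash^{v}N:\mathtt{b}$ infer $\tfrac12\cdot\Gamma\uplus\tfrac12\cdot\Delta\vdash^{\frac12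 w+\frac12 v+1}M\oplus N:\tfrac12\mathtt{a}\sqcup\tfrac12\mathtt{b}$. ($\lambda$) from $\Gamma,x:\mathcal{M}\vdash^{w}M:\mathtt{b}$ infer $\Gamma\vdash^{w+1}\lambda x.M:\mathcal{M}\to\mathtt{b}$. (let) from $\Gamma\vdash^{v}N:\langle p_k\mathcal{M}_k\rangle_{k\in K}$ and $\Delta_k,x:\mathcal{M}_k\vdash^{w_k}M:\mathtt{b}_k$ ($k\in K$) infer $\Gamma\uplus_{k}p_k\cdot\Delta_k\vdash^{\sum_k p_kw_k+v+1}\mathtt{let}\ x=N\ \mathtt{in}\ M:\bigsqcup_k p_k\mathtt{b}_k$. (Val) from $\Gamma\vdash^{w}V:\mathcal{M}$ infer $\Gamma\vdash^{w}V:\langle 1\mathcal{M}\rangle$. (!) for finite possibly empty $I$, from $\Gamma_i\vdash^{w_i}V:\mathtt{A}_i$ and scale factors $q_i$ infer $\uplus_i q_i\cdot\Gamma_i\vdash^{\sum_i q_iw_i}V:[q_i\cdot\mathtt{A}_i]_{i\in I}$. A type distribution is tight if it has the form $\langle q_k[\,]\rangle_{k\in K}$ ($K$ possibly empty); a derivation of $\vdash^{w}M:\mathtt{a}$ (empty context) is tight if $\mathtt{a}$ is tight. -}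

module Defs where

open import Data.Nat using (ℕ; zero; suc)
open import Data.Fin using (Fin; zero; suc)
open import Data.Rational using (ℚ; 0ℚ; 1ℚ; ½; _+_; _*_; _-_; _≤_; _<_)
open import Data.List using (List; []; _∷_; _++_; map; concatMap)
open import Data.List.Relation.Unary.All using (All)
open import Data.Vec using (Vec; []; _∷_; replicate; zipWith; _[_]≔_)
import Data.Vec as Vec
open import Data.Vec.Relation.Binary.Pointwise.Inductive using (Pointwise)
open import Data.Product using (_×_; _,_; proj₁; proj₂)
open import Relation.Binary.PropositionalEquality using (_≡_)

-- Terms (well-scoped de Bruijn syntax; Tm 0 = closed terms)
-- values V ::= x | λx.M ;  terms M ::= V | V V | M ⊕ M | let x = M in M

infixr 6 _⊕_

mutual
  data Val (n : ℕ) : Set where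
    var : Fin n → Val n
    lam : Tm (suc n) → Val n

  data Tm (n : ℕ) : Set where
    val   : Val n → Tm n
    app   : Val n → Val n → Tm n
    _⊕_   : Tm n → Tm n → Tm n
    letin : Tm n → Tm (suc n) → Tm n

ext : ∀ {m n} → (Fin m → Fin n) → Fin (suc m) → Fin (suc n)
ext ρ zero    = zero
ext ρ (suc i) = suc (ρ i)

mutual
  renV : ∀ {m n} → (Fin m → Fin n) → Val m → Val n
  renV ρ (var x) = var (ρ x)
  renV ρ (lam t) = lam (renT (ext ρ) t)

  renT : ∀ {m n} → (Fin m → Fin n) → Tm m → Tm n
  renT ρ (val v)     = val (renV ρ v)
  renT ρ (app v w)   = app (renV ρ v) (renV ρ w)
  renT ρ (t ⊕ u)     = renT ρ t ⊕ renT ρ u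
  renT ρ (letin t u) = letin (renT ρ t) (renT (ext ρ) u)

exts : ∀ {m n} → (Fin m → Val n) → Fin (suc m) → Val (suc n)
exts σ zero    = var zero
exts σ (suc i) = renV suc (σ i)

mutual
  subV : ∀ {m n} → (Fin m → Val n) → Val m → Val n
  subV σ (var x) = σ x
  subV σ (lam t) = lam (subT (exts σ) t)

  subT : ∀ {m n} → (Fin m → Val n) → Tm m → Tm n
  subT σ (val v)     = val (subV σ v)
  subT σ (app v w)   = app (subV σ v) (subV σ w)
  subT σ (t ⊕ u)     = subT σ t ⊕ subT σ u
  subT σ (letin t u) = letin (subT σ t) (subT (exts σ) u)

_[_/0] : ∀ {n} → Tm (suc n) → Val n → Tm n
M [ V /0] = subT σ M
  where
  σ : _
  σ zero    = V
  σ (suc i) = var i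

-- Multidistributions of closed terms: finite multisets ⟨p_i M_i⟩,
-- represented as lists of (probability , term).

MDist : Set
MDist = List (ℚ × Tm 0)

scaleM : ℚ → MDist → MDist
scaleM q = map (λ pM → (q * proj₁ pM , proj₂ pM))

-- It is deterministic, so it is
-- given as a function.  `stepApp`, `stepLet` cover exactly the
-- non-value terms; `liftTerm` is the m_i of the lifting rule
-- (⟨1 M⟩ if M is a value, the reduct of M otherwise).
mutual
  stepApp : Val 0 → Val 0 → MDist
  stepApp (var ())  _
  stepApp (lam M) V = (1ℚ , M [ V /0]) ∷ []

  stepLet : Tm 0 → Tm 1 → MDist
  stepLet (val V) M = (1ℚ , M [ V /0]) ∷ []
  stepLet N       M = map (λ pN → (proj₁ pN , letin (proj₂ pN) M)) (liftTerm N)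
    -- N is not a value here, so liftTerm N is the reduct N → ⟨p_i N_i⟩

  liftTerm : Tm 0 → MDist
  liftTerm (val V)     = (1ℚ , val V) ∷ []
  liftTerm (app V W)   = stepApp V W
  liftTerm (M ⊕ N)     = (½ , M) ∷ (½ , N) ∷ []
  liftTerm (letin N M) = stepLet N M

liftStep : MDist → MDist
liftStep = concatMap (λ pM → scaleM (proj₁ pM) (liftTerm (proj₂ pM)))

mdist : ℕ → Tm 0 → MDist
mdist zero    M = (1ℚ , M) ∷ []
mdist (suc k) M = liftStep (mdist k M)

isValueProb : ℚ × Tm 0 → ℚ
isValueProb (p , val _) = p
isValueProb (p , _)     = 0ℚ

sumℚ : List ℚ → ℚ
sumℚ []       = 0ℚ
sumℚ (x ∷ xs) = x + sumℚ xs

Prob : ℕ → Tm 0 → ℚ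
Prob k M = sumℚ (map isValueProb (mdist k M))

Exp : ℕ → Tm 0 → ℚ
Exp zero    M = 0ℚ
Exp (suc k) M = Exp k M + (1ℚ - Prob k M)

-- Types.  Multisets are represented by lists; equality of types is
-- multiset equality (recursively), the relations ≈A/≈I/≈D below.

data Arr : Set where
  _⇒_ : List (ℚ × Arr) → List (ℚ × List (ℚ × Arr)) → Arr

Inter : Set
Inter = List (ℚ × Arr)

TDist : Set
TDist = List (ℚ × Inter)

𝟎 : TDist
𝟎 = []

norm : TDist → ℚ
norm a = sumℚ (map proj₁ a)

scaleI : ℚ → Inter → Inter
scaleI u = map (λ qA → (u * proj₁ qA , proj₂ qA))

scaleD : ℚ → TDist → TDist
scaleD u = map (λ pM → (u * proj₁ pM , proj₂ pM))

InUnit : ℚ → Set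
InUnit q = (0ℚ < q) × (q ≤ 1ℚ)

mutual
  data WFA : Arr → Set where
    wf⇒ : ∀ {𝓜 a} → WFI 𝓜 → WFD a → WFA (𝓜 ⇒ a)

  data WFI : Inter → Set where
    []  : WFI []
    _∷_ : ∀ {q A 𝓜} → InUnit q × WFA A → WFI 𝓜 → WFI ((q , A) ∷ 𝓜)

  data WFDe : TDist → Set where
    []  : WFDe []
    _∷_ : ∀ {p 𝓜 a} → InUnit p × WFI 𝓜 → WFDe a → WFDe ((p , 𝓜) ∷ a)

  WFD : TDist → Set
  WFD a = WFDe a × (norm a ≤ 1ℚ)

mutual
  data _≈A_ : Arr → Arr → Set where
    ≈⇒ : ∀ {𝓜 𝓜' a a'} → 𝓜 ≈I 𝓜' → a ≈D a' → (𝓜 ⇒ a) ≈A (𝓜' ⇒ a')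

  data _≈I_ : Inter → Inter → Set where
    []  : [] ≈I []
    cons : ∀ {q A A' xs ys₁ ys₂} → A ≈A A' → xs ≈I (ys₁ ++ ys₂) →
           ((q , A) ∷ xs) ≈I (ys₁ ++ (q , A') ∷ ys₂)

  data _≈D_ : TDist → TDist → Set where
    []  : [] ≈D []
    cons : ∀ {p 𝓜 𝓜' xs ys₁ ys₂} → 𝓜 ≈I 𝓜' → xs ≈D (ys₁ ++ ys₂) →
           ((p , 𝓜) ∷ xs) ≈D (ys₁ ++ (p , 𝓜') ∷ ys₂)

Ctx : ℕ → Set
Ctx n = Vec Inter n

∅ : ∀ {n} → Ctx n
∅ = replicate _ []

_⊎_ : ∀ {n} → Ctx n → Ctx n → Ctx n
_⊎_ = zipWith _++_

_·_ : ∀ {n} → ℚ → Ctx n → Ctx n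
u · Γ = Vec.map (scaleI u) Γ

_≈C_ : ∀ {n} → Ctx n → Ctx n → Set
_≈C_ = Pointwise _≈I_

single : ∀ {n} → Fin n → Inter → Ctx n
single x 𝓜 = ∅ [ x ]≔ 𝓜

⨄ : ∀ {n m} → (Fin m → Ctx n) → Ctx n
⨄ {m = zero}  Γ = ∅
⨄ {m = suc m} Γ = Γ zero ⊎ ⨄ (λ i → Γ (suc i))

Σℚ : ∀ {m} → (Fin m → ℚ) → ℚ
Σℚ {zero}  f = 0ℚ
Σℚ {suc m} f = f zero + Σℚ (λ i → f (suc i))

tab : ∀ {m} {A : Set} → (Fin m → A) → List A
tab {zero}  f = []
tab {suc m} f = f zero ∷ tab (λ i → f (suc i))

⨆ : ∀ {m} → (Fin m → TDist) → TDist
⨆ {zero}  f = []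
⨆ {suc m} f = f zero ++ ⨆ (λ i → f (suc i))

-- Type system  Γ ⊢^w M : τ
--   Γ ⊢A[ w ] V ∶ A   (arrow types, values)
--   Γ ⊢I[ w ] V ∶ 𝓜   (intersection types, values)
--   Γ ⊢D[ w ] M ∶ a   (type distributions, terms)
-- Types (and contexts) are multisets: `conv*` rules identify
-- list representations that are equal as multisets.

mutual
  data _⊢A[_]_∶_ {n : ℕ} : Ctx n → ℚ → Val n → Arr → Set where
    ⊢λ : ∀ {Γ 𝓜 w M b} →
         (𝓜 ∷ Γ) ⊢D[ w ] M ∶ b →
         Γ ⊢A[ w + 1ℚ ] lam M ∶ (𝓜 ⇒ b)
    convA : ∀ {Γ Γ' w V A A'} → Γ ≈C Γ' → A ≈A A' →
            Γ ⊢A[ w ] V ∶ A → Γ' ⊢A[ w ] V ∶ A'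

  data _⊢I[_]_∶_ {n : ℕ} : Ctx n → ℚ → Val n → Inter → Set where
    ⊢var : ∀ {x 𝓜} → WFI 𝓜 → single x 𝓜 ⊢I[ 0ℚ ] var x ∶ 𝓜
    -- (!)  (I = Fin m, possibly empty)
    ⊢! : ∀ {m V} (q : Fin m → ℚ) (A : Fin m → Arr)
           (Γ : Fin m → Ctx n) (w : Fin m → ℚ) →
         (∀ i → InUnit (q i)) →
         (∀ i → Γ i ⊢A[ w i ] V ∶ A i) →
         ⨄ (λ i → q i · Γ i) ⊢I[ Σℚ (λ i → q i * w i) ] V
            ∶ tab (λ i → (q i , A i))
    convI : ∀ {Γ Γ' w V 𝓜 𝓜'} → Γ ≈C Γ' → 𝓜 ≈I 𝓜' →
            Γ ⊢I[ w ] V ∶ 𝓜 → Γ' ⊢I[ w ] V ∶ 𝓜'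

  data _⊢D[_]_∶_ {n : ℕ} : Ctx n → ℚ → Tm n → TDist → Set where
    ⊢zero : ∀ {M} → ∅ ⊢D[ 0ℚ ] M ∶ 𝟎
    ⊢app : ∀ {Γ Δ w v V W 𝓜 b} →
           Γ ⊢I[ w ] V ∶ ((1ℚ , (𝓜 ⇒ b)) ∷ []) →
           Δ ⊢I[ v ] W ∶ 𝓜 →
           (Γ ⊎ Δ) ⊢D[ w + v ] app V W ∶ b
    ⊢⊕ : ∀ {Γ Δ w v M N a b} →
         Γ ⊢D[ w ] M ∶ a → Δ ⊢D[ v ] N ∶ b →
         ((½ · Γ) ⊎ (½ · Δ)) ⊢D[ ½ * w + ½ * v + 1ℚ ] (M ⊕ N)
            ∶ (scaleD ½ a ++ scaleD ½ b)
    ⊢let : ∀ {m Γ v N M} (p : Fin m → ℚ) (𝓜 : Fin m → Inter)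
             (Δ : Fin m → Ctx n) (w : Fin m → ℚ) (b : Fin m → TDist) →
           Γ ⊢D[ v ] N ∶ tab (λ k → (p k , 𝓜 k)) →
           (∀ k → (𝓜 k ∷ Δ k) ⊢D[ w k ] M ∶ b k) →
           (Γ ⊎ ⨄ (λ k → p k · Δ k))
             ⊢D[ Σℚ (λ k → p k * w k) + v + 1ℚ ] letin N M
             ∶ ⨆ (λ k → scaleD (p k) (b k))
    ⊢val : ∀ {Γ w V 𝓜} → Γ ⊢I[ w ] V ∶ 𝓜 →
           Γ ⊢D[ w ] val V ∶ ((1ℚ , 𝓜) ∷ [])
    convD : ∀ {Γ Γ' w M a a'} → Γ ≈C Γ' → a ≈D a' →
            Γ ⊢D[ w ] M ∶ a → Γ' ⊢D[ w ] M ∶ a'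

Tight : TDist → Set
Tight a = All (λ p𝓜 → proj₂ p𝓜 ≡ []) a

-- For k = 0, a value is typed by (Val) and any other term by (Zero). For k + 1,
-- a non-value M reduces in one step to ⟨pᵢ Mᵢ⟩; the induction hypothesis gives tight typings of
-- the Mᵢ, and subject expansion assembles them into a typing of M whose weight exceeds their
-- pᵢ-weighted sum by at least 1. This matches P_{k+1}(M) = Σ pᵢ P_k(Mᵢ) and
-- E_{k+1}(M) = 1 + Σ pᵢ E_k(Mᵢ), which hold by linearity of the lifted reduction.
-- Expanding a β- or let-redex needs anti-substitution. It is proved for a syntax-directed
-- variant of the type system whose contexts are lists of variable occurrences; derivations of
-- the variant are then translated into ⊢D.
module Submission where

open import Defs
open import Data.Nat using (ℕ; zero; suc)
open import Data.Fin using (Fin; zero; suc)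
open import Data.Fin.Properties using (_≟_)
open import Data.Bool using (true; false; if_then_else_)
open import Data.Rational using (ℚ; 0ℚ; 1ℚ; ½; _+_; _*_; _-_; _≤_; positive; NonNegative)
import Data.Rational.Properties as ℚ
open import Data.Rational.Solver using (module +-*-Solver)
open +-*-Solver using (solve; _:+_; _:*_; _:-_; _:=_; con)
open import Data.List using (List; []; _∷_; [_]; _++_; map; mapMaybe)
import Data.List.Properties as List
open import Data.List.Membership.Propositional.Properties using (∈-∃++)
open import Data.List.Relation.Binary.Permutation.Propositional
  using (_↭_; ↭-refl; ↭-sym; ↭-trans; ↭-prep; ↭-reflexive)
import Data.List.Relation.Binary.Permutation.Propositional.Properties as ↭
open import Data.List.Relation.Unary.All using (All; []; _∷_)
import Data.List.Relation.Unary.All.Properties as All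
open import Data.List.Relation.Unary.Any using (here)
open import Data.Maybe using (Maybe; just; nothing)
open import Data.Product using (Σ; _×_; _,_; proj₁; proj₂)
open import Data.Unit using (⊤; tt)
open import Data.Empty using (⊥)
open import Data.Vec using (_∷_; lookup; tabulate)
import Data.Vec.Properties as Vec
import Data.Vec.Functional as Vector
open import Data.Vec.Relation.Binary.Pointwise.Inductive using (_∷_; tabulate⁺)
open import Relation.Binary.PropositionalEquality hiding ([_])
open import Relation.Nullary using (does)
open import Function using (_∘_)

½-inUnit : InUnit ½
½-inUnit = ℚ.positive⁻¹ ½ , ℚ.≤ᵇ⇒≤ _

1-inUnit : InUnit 1ℚ
1-inUnit = ℚ.positive⁻¹ 1ℚ , ℚ.≤-refl

*-inUnit : ∀ {p q} → InUnit p → InUnit q → InUnit (p * q)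
*-inUnit {p} {q} (p>0 , p≤1) (q>0 , q≤1) =
  ℚ.positive⁻¹ (p * q) {{ℚ.pos*pos⇒pos p {{positive p>0}} q {{positive q>0}}}} ,
  ℚ.≤-trans (ℚ.*-monoˡ-≤-nonNeg p {{ℚ.pos⇒nonNeg p {{positive p>0}}}} q≤1)
            (ℚ.≤-trans (ℚ.≤-reflexive (ℚ.*-identityʳ p)) p≤1)

mutual
  renV-cong : ∀ {m n} {ρ ρ' : Fin m → Fin n} → ρ ≗ ρ' → ∀ v → renV ρ v ≡ renV ρ' v
  renV-cong e (var x) = cong var (e x)
  renV-cong e (lam t) = cong lam (renT-cong (ext-cong e) t)

  renT-cong : ∀ {m n} {ρ ρ' : Fin m → Fin n} → ρ ≗ ρ' → ∀ t → renT ρ t ≡ renT ρ' t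
  renT-cong e (val v)     = cong val (renV-cong e v)
  renT-cong e (app v w)   = cong₂ app (renV-cong e v) (renV-cong e w)
  renT-cong e (t ⊕ u)     = cong₂ _⊕_ (renT-cong e t) (renT-cong e u)
  renT-cong e (letin t u) = cong₂ letin (renT-cong e t) (renT-cong (ext-cong e) u)

  ext-cong : ∀ {m n} {ρ ρ' : Fin m → Fin n} → ρ ≗ ρ' → ext ρ ≗ ext ρ'
  ext-cong e zero    = refl
  ext-cong e (suc i) = cong suc (e i)

ext-∘ : ∀ {l m n} (ρ : Fin m → Fin n) (ρ' : Fin l → Fin m) → ext ρ ∘ ext ρ' ≗ ext (ρ ∘ ρ')
ext-∘ ρ ρ' zero    = refl
ext-∘ ρ ρ' (suc i) = refl

mutual
  renV-∘ : ∀ {l m n} (ρ : Fin m → Fin n) (ρ' : Fin l → Fin m) v →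
           renV ρ (renV ρ' v) ≡ renV (ρ ∘ ρ') v
  renV-∘ ρ ρ' (var x) = refl
  renV-∘ ρ ρ' (lam t) = cong lam (renT-∘-ext ρ ρ' t)

  renT-∘ : ∀ {l m n} (ρ : Fin m → Fin n) (ρ' : Fin l → Fin m) t →
           renT ρ (renT ρ' t) ≡ renT (ρ ∘ ρ') t
  renT-∘ ρ ρ' (val v)     = cong val (renV-∘ ρ ρ' v)
  renT-∘ ρ ρ' (app v w)   = cong₂ app (renV-∘ ρ ρ' v) (renV-∘ ρ ρ' w)
  renT-∘ ρ ρ' (t ⊕ u)     = cong₂ _⊕_ (renT-∘ ρ ρ' t) (renT-∘ ρ ρ' u)
  renT-∘ ρ ρ' (letin t u) = cong₂ letin (renT-∘ ρ ρ' t) (renT-∘-ext ρ ρ' u)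

  renT-∘-ext : ∀ {l m n} (ρ : Fin m → Fin n) (ρ' : Fin l → Fin m) t →
               renT (ext ρ) (renT (ext ρ') t) ≡ renT (ext (ρ ∘ ρ')) t
  renT-∘-ext ρ ρ' t = trans (renT-∘ (ext ρ) (ext ρ') t) (renT-cong (ext-∘ ρ ρ') t)

mutual
  subV-cong : ∀ {m n} {σ σ' : Fin m → Val n} → σ ≗ σ' → ∀ v → subV σ v ≡ subV σ' v
  subV-cong e (var x) = e x
  subV-cong e (lam t) = cong lam (subT-cong (exts-cong e) t)

  subT-cong : ∀ {m n} {σ σ' : Fin m → Val n} → σ ≗ σ' → ∀ t → subT σ t ≡ subT σ' t
  subT-cong e (val v)     = cong val (subV-cong e v)
  subT-cong e (app v w)   = cong₂ app (subV-cong e v) (subV-cong e w)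
  subT-cong e (t ⊕ u)     = cong₂ _⊕_ (subT-cong e t) (subT-cong e u)
  subT-cong e (letin t u) = cong₂ letin (subT-cong e t) (subT-cong (exts-cong e) u)

  exts-cong : ∀ {m n} {σ σ' : Fin m → Val n} → σ ≗ σ' → exts σ ≗ exts σ'
  exts-cong e zero    = refl
  exts-cong e (suc i) = cong (renV suc) (e i)

var-ext : ∀ {m n} (ρ : Fin m → Fin n) → var ∘ ext ρ ≗ exts (var ∘ ρ)
var-ext ρ zero    = refl
var-ext ρ (suc i) = refl

mutual
  renV-as-subV : ∀ {m n} (ρ : Fin m → Fin n) v → renV ρ v ≡ subV (var ∘ ρ) v
  renV-as-subV ρ (var x) = refl
  renV-as-subV ρ (lam t) = cong lam (renT-ext-as-subT ρ t)

  renT-as-subT : ∀ {m n} (ρ : Fin m → Fin n) t → renT ρ t ≡ subT (var ∘ ρ) t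
  renT-as-subT ρ (val v)     = cong val (renV-as-subV ρ v)
  renT-as-subT ρ (app v w)   = cong₂ app (renV-as-subV ρ v) (renV-as-subV ρ w)
  renT-as-subT ρ (t ⊕ u)     = cong₂ _⊕_ (renT-as-subT ρ t) (renT-as-subT ρ u)
  renT-as-subT ρ (letin t u) = cong₂ letin (renT-as-subT ρ t) (renT-ext-as-subT ρ u)

  renT-ext-as-subT : ∀ {m n} (ρ : Fin m → Fin n) t → renT (ext ρ) t ≡ subT (exts (var ∘ ρ)) t
  renT-ext-as-subT ρ t = trans (renT-as-subT (ext ρ) t) (subT-cong (var-ext ρ) t)

Occ : ℕ → Set
Occ n = List (Fin n × (ℚ × Arr))

scaleO : ∀ {n} → ℚ → Occ n → Occ n
scaleO u = map (λ xqA → (proj₁ xqA , (u * proj₁ (proj₂ xqA) , proj₂ (proj₂ xqA))))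

renameO : ∀ {m n} → (Fin m → Fin n) → Occ m → Occ n
renameO ρ = map (λ xqA → (ρ (proj₁ xqA) , proj₂ xqA))

zeroO : ∀ {n} → Inter → Occ (suc n)
zeroO = map (zero ,_)

extendO : ∀ {n} → Inter → Occ n → Occ (suc n)
extendO 𝓜 Γ = zeroO 𝓜 ++ renameO suc Γ

-- Γ ⊩q[ w ] V ∶ (q , A) is one premise of rule (!), already scaled by q, and Δ ⊩F[ w ] M ∶ a ↦ b
-- collects the premises of (let) for the body M. Permutations of occurrence lists replace the
-- conversion rules, so every rule can be inverted. Since (Var) requires a well-formed type,
-- ⊩var and ⊩λ record well-formedness.
infix 4 _⊩q[_]_∶_ _⊩A[_]λ_∶_ _⊩I[_]_∶_ _⊩D[_]_∶_ _⊩F[_]_∶_↦_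

mutual
  data _⊩q[_]_∶_ {n : ℕ} : Occ n → ℚ → Val n → ℚ × Arr → Set where
    ⊩var : ∀ {x q A} → InUnit q → WFA A → (x , (q , A)) ∷ [] ⊩q[ 0ℚ ] var x ∶ (q , A)
    ⊩lam : ∀ {Γ w M q A} → InUnit q → Γ ⊩A[ w ]λ M ∶ A → scaleO q Γ ⊩q[ q * w ] lam M ∶ (q , A)

  data _⊩A[_]λ_∶_ {n : ℕ} : Occ n → ℚ → Tm (suc n) → Arr → Set where
    ⊩λ : ∀ {Θ Γ w M 𝓜 b} → WFI 𝓜 → WFD b → Θ ⊩D[ w ] M ∶ b → Θ ↭ extendO 𝓜 Γ →
         Γ ⊩A[ w + 1ℚ ]λ M ∶ (𝓜 ⇒ b)

  data _⊩I[_]_∶_ {n : ℕ} : Occ n → ℚ → Val n → Inter → Set where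
    []  : ∀ {V} → [] ⊩I[ 0ℚ ] V ∶ []
    _∷_ : ∀ {Γ Δ w v V qA 𝓜} → Γ ⊩q[ w ] V ∶ qA → Δ ⊩I[ v ] V ∶ 𝓜 →
          Γ ++ Δ ⊩I[ w + v ] V ∶ qA ∷ 𝓜

  data _⊩D[_]_∶_ {n : ℕ} : Occ n → ℚ → Tm n → TDist → Set where
    ⊩zero : ∀ {M} → [] ⊩D[ 0ℚ ] M ∶ []
    ⊩val  : ∀ {Γ w V 𝓜} → Γ ⊩I[ w ] V ∶ 𝓜 → Γ ⊩D[ w ] val V ∶ (1ℚ , 𝓜) ∷ []
    ⊩app  : ∀ {Γ Δ w v V W 𝓜 b} → Γ ⊩I[ w ] V ∶ (1ℚ , (𝓜 ⇒ b)) ∷ [] → Δ ⊩I[ v ] W ∶ 𝓜 →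
            Γ ++ Δ ⊩D[ w + v ] app V W ∶ b
    ⊩⊕    : ∀ {Γ Δ w v M N a b} → Γ ⊩D[ w ] M ∶ a → Δ ⊩D[ v ] N ∶ b →
            scaleO ½ Γ ++ scaleO ½ Δ ⊩D[ ½ * w + ½ * v + 1ℚ ] M ⊕ N ∶ scaleD ½ a ++ scaleD ½ b
    ⊩let  : ∀ {Γ v N M a Δ ws b} → Γ ⊩D[ v ] N ∶ a → Δ ⊩F[ ws ] M ∶ a ↦ b →
            Γ ++ Δ ⊩D[ ws + v + 1ℚ ] letin N M ∶ b

  data _⊩F[_]_∶_↦_ {n : ℕ} : Occ n → ℚ → Tm (suc n) → TDist → TDist → Set where
    []   : ∀ {M} → [] ⊩F[ 0ℚ ] M ∶ [] ↦ []
    cons : ∀ {Θ Δ w M b p 𝓜 a Δs ws bs} → InUnit p → Θ ⊩D[ w ] M ∶ b → Θ ↭ extendO 𝓜 Δ →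
           Δs ⊩F[ ws ] M ∶ a ↦ bs →
           scaleO p Δ ++ Δs ⊩F[ p * w + ws ] M ∶ (p , 𝓜) ∷ a ↦ scaleD p b ++ bs

scaleO-++ : ∀ {n} u (Γ Δ : Occ n) → scaleO u (Γ ++ Δ) ≡ scaleO u Γ ++ scaleO u Δ
scaleO-++ u = List.map-++ _

renameO-++ : ∀ {m n} (ρ : Fin m → Fin n) (Γ Δ : Occ m) → renameO ρ (Γ ++ Δ) ≡ renameO ρ Γ ++ renameO ρ Δ
renameO-++ ρ = List.map-++ _

scaleO-scaleO : ∀ {n} p q (Γ : Occ n) → scaleO p (scaleO q Γ) ≡ scaleO (p * q) Γ
scaleO-scaleO p q [] = refl
scaleO-scaleO p q ((x , (r , A)) ∷ Γ) =
  cong₂ _∷_ (cong (λ z → (x , (z , A))) (sym (ℚ.*-assoc p q r))) (scaleO-scaleO p q Γ)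

renameO-scaleO : ∀ {m n} (ρ : Fin m → Fin n) q Γ → renameO ρ (scaleO q Γ) ≡ scaleO q (renameO ρ Γ)
renameO-scaleO ρ q [] = refl
renameO-scaleO ρ q (_ ∷ Γ) = cong (_ ∷_) (renameO-scaleO ρ q Γ)

renameO-∘ : ∀ {l m n} (ρ : Fin m → Fin n) (ρ' : Fin l → Fin m) Γ →
            renameO ρ (renameO ρ' Γ) ≡ renameO (ρ ∘ ρ') Γ
renameO-∘ ρ ρ' [] = refl
renameO-∘ ρ ρ' (_ ∷ Γ) = cong (_ ∷_) (renameO-∘ ρ ρ' Γ)

renameO-extendO : ∀ {m n} (ρ : Fin m → Fin n) 𝓜 Γ →
                  renameO (ext ρ) (extendO 𝓜 Γ) ≡ extendO 𝓜 (renameO ρ Γ)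
renameO-extendO ρ (qA ∷ 𝓜) Γ = cong (_ ∷_) (renameO-extendO ρ 𝓜 Γ)
renameO-extendO ρ [] [] = refl
renameO-extendO ρ [] (_ ∷ Γ) = cong (_ ∷_) (renameO-extendO ρ [] Γ)

zeroPart : ∀ {n} → Fin (suc n) × (ℚ × Arr) → Maybe (ℚ × Arr)
zeroPart (zero , qA)  = just qA
zeroPart (suc _ , _)  = nothing

sucPart : ∀ {n} → Fin (suc n) × (ℚ × Arr) → Maybe (Fin n × (ℚ × Arr))
sucPart (zero , qA)  = nothing
sucPart (suc x , qA) = just (x , qA)

zeroPart-extendO : ∀ {n} 𝓜 (Γ : Occ n) → mapMaybe zeroPart (extendO 𝓜 Γ) ≡ 𝓜
zeroPart-extendO (qA ∷ 𝓜) Γ = cong (qA ∷_) (zeroPart-extendO 𝓜 Γ)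
zeroPart-extendO [] [] = refl
zeroPart-extendO [] (_ ∷ Γ) = zeroPart-extendO [] Γ

sucPart-extendO : ∀ {n} 𝓜 (Γ : Occ n) → mapMaybe sucPart (extendO 𝓜 Γ) ≡ Γ
sucPart-extendO (qA ∷ 𝓜) Γ = sucPart-extendO 𝓜 Γ
sucPart-extendO [] [] = refl
sucPart-extendO [] (x ∷ Γ) = cong (x ∷_) (sucPart-extendO [] Γ)

extendO-↭-inv : ∀ {n} {𝓜 𝓝} {Γ Δ : Occ n} → extendO 𝓜 Γ ↭ extendO 𝓝 Δ → 𝓜 ↭ 𝓝 × Γ ↭ Δ
extendO-↭-inv {𝓜 = 𝓜} {𝓝} {Γ} {Δ} p =
  subst₂ _↭_ (zeroPart-extendO 𝓜 Γ) (zeroPart-extendO 𝓝 Δ) (↭.mapMaybe-↭ zeroPart p) ,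
  subst₂ _↭_ (sucPart-extendO 𝓜 Γ) (sucPart-extendO 𝓝 Δ) (↭.mapMaybe-↭ sucPart p)

extendO-↭ˡ : ∀ {n} {𝓜 𝓝 : Inter} (Γ : Occ n) → 𝓜 ↭ 𝓝 → extendO 𝓜 Γ ↭ extendO 𝓝 Γ
extendO-↭ˡ Γ p = ↭.++⁺ʳ _ (↭.map⁺ _ p)

⊩q-cast : ∀ {n Γ Γ' w w' V qA} → Γ ≡ Γ' → w ≡ w' → _⊩q[_]_∶_ {n} Γ w V qA → Γ' ⊩q[ w' ] V ∶ qA
⊩q-cast refl refl d = d

⊩I-cast : ∀ {n Γ Γ' w w' V 𝓜} → Γ ≡ Γ' → w ≡ w' → _⊩I[_]_∶_ {n} Γ w V 𝓜 → Γ' ⊩I[ w' ] V ∶ 𝓜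
⊩I-cast refl refl d = d

⊩D-cast : ∀ {n Γ Γ' w w' M a} → Γ ≡ Γ' → w ≡ w' → _⊩D[_]_∶_ {n} Γ w M a → Γ' ⊩D[ w' ] M ∶ a
⊩D-cast refl refl d = d

⊩F-cast : ∀ {n Γ Γ' w w' M a b b'} → Γ ≡ Γ' → w ≡ w' → b ≡ b' → _⊩F[_]_∶_↦_ {n} Γ w M a b →
          Γ' ⊩F[ w' ] M ∶ a ↦ b'
⊩F-cast refl refl refl d = d

⊩q-wf : ∀ {n Γ w V q A} → _⊩q[_]_∶_ {n} Γ w V (q , A) → InUnit q × WFA A
⊩q-wf (⊩var u a)              = u , a
⊩q-wf (⊩lam u (⊩λ wi wd d p)) = u , wf⇒ wi wd

mutual
  ⊩q-rename : ∀ {m n} (ρ : Fin m → Fin n) {Γ w V qA} → Γ ⊩q[ w ] V ∶ qA →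
              renameO ρ Γ ⊩q[ w ] renV ρ V ∶ qA
  ⊩q-rename ρ (⊩var u a) = ⊩var u a
  ⊩q-rename ρ (⊩lam {Γ = Γ} {q = q} u d) =
    ⊩q-cast (sym (renameO-scaleO ρ q Γ)) refl (⊩lam u (⊩A-rename ρ d))

  ⊩A-rename : ∀ {m n} (ρ : Fin m → Fin n) {Γ w M A} → Γ ⊩A[ w ]λ M ∶ A →
              renameO ρ Γ ⊩A[ w ]λ renT (ext ρ) M ∶ A
  ⊩A-rename ρ (⊩λ {Γ = Γ} {𝓜 = 𝓜} wi wd d p) =
    ⊩λ wi wd (⊩D-rename (ext ρ) d) (↭-trans (↭.map⁺ _ p) (↭-reflexive (renameO-extendO ρ 𝓜 Γ)))

  ⊩I-rename : ∀ {m n} (ρ : Fin m → Fin n) {Γ w V 𝓜} → Γ ⊩I[ w ] V ∶ 𝓜 →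
              renameO ρ Γ ⊩I[ w ] renV ρ V ∶ 𝓜
  ⊩I-rename ρ [] = []
  ⊩I-rename ρ (_∷_ {Γ = Γ} {Δ = Δ} v i) =
    ⊩I-cast (sym (renameO-++ ρ Γ Δ)) refl (⊩q-rename ρ v ∷ ⊩I-rename ρ i)

  ⊩D-rename : ∀ {m n} (ρ : Fin m → Fin n) {Γ w M a} → Γ ⊩D[ w ] M ∶ a →
              renameO ρ Γ ⊩D[ w ] renT ρ M ∶ a
  ⊩D-rename ρ ⊩zero = ⊩zero
  ⊩D-rename ρ (⊩val i) = ⊩val (⊩I-rename ρ i)
  ⊩D-rename ρ (⊩app {Γ = Γ} {Δ = Δ} i j) =
    ⊩D-cast (sym (renameO-++ ρ Γ Δ)) refl (⊩app (⊩I-rename ρ i) (⊩I-rename ρ j))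
  ⊩D-rename ρ (⊩⊕ {Γ = Γ} {Δ = Δ} d e) =
    ⊩D-cast (sym (trans (renameO-++ ρ (scaleO ½ Γ) (scaleO ½ Δ))
                        (cong₂ _++_ (renameO-scaleO ρ ½ Γ) (renameO-scaleO ρ ½ Δ))))
            refl (⊩⊕ (⊩D-rename ρ d) (⊩D-rename ρ e))
  ⊩D-rename ρ (⊩let {Γ = Γ} {Δ = Δ} d f) =
    ⊩D-cast (sym (renameO-++ ρ Γ Δ)) refl (⊩let (⊩D-rename ρ d) (⊩F-rename ρ f))

  ⊩F-rename : ∀ {m n} (ρ : Fin m → Fin n) {Γ w M a b} → Γ ⊩F[ w ] M ∶ a ↦ b →
              renameO ρ Γ ⊩F[ w ] renT (ext ρ) M ∶ a ↦ b
  ⊩F-rename ρ [] = []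
  ⊩F-rename ρ (cons {Δ = Δ} {p = p} {𝓜 = 𝓜} {Δs = Δs} u d q f) =
    ⊩F-cast (sym (trans (renameO-++ ρ (scaleO p Δ) Δs)
                        (cong (_++ renameO ρ Δs) (renameO-scaleO ρ p Δ))))
            refl refl
            (cons u (⊩D-rename (ext ρ) d) (↭-trans (↭.map⁺ _ q) (↭-reflexive (renameO-extendO ρ 𝓜 Δ)))
                  (⊩F-rename ρ f))

infix 4 _⊩S[_]_∶_

data _⊩S[_]_∶_ {m n : ℕ} : Occ n → ℚ → (Fin m → Val n) → Occ m → Set where
  []  : ∀ {σ} → [] ⊩S[ 0ℚ ] σ ∶ []
  _∷_ : ∀ {σ i qA Γ w Γs ws Δ} → Γ ⊩q[ w ] σ i ∶ qA → Γs ⊩S[ ws ] σ ∶ Δ →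
        Γ ++ Γs ⊩S[ w + ws ] σ ∶ (i , qA) ∷ Δ

⊩S-cast : ∀ {m n σ Δ Γ Γ' w w'} → Γ ≡ Γ' → w ≡ w' → _⊩S[_]_∶_ {m} {n} Γ w σ Δ → Γ' ⊩S[ w' ] σ ∶ Δ
⊩S-cast refl refl s = s

⊩S-++ : ∀ {m n σ Δ₁ Γ₁ w₁ Δ₂ Γ₂ w₂} → _⊩S[_]_∶_ {m} {n} Γ₁ w₁ σ Δ₁ → Γ₂ ⊩S[ w₂ ] σ ∶ Δ₂ →
        Γ₁ ++ Γ₂ ⊩S[ w₁ + w₂ ] σ ∶ Δ₁ ++ Δ₂
⊩S-++ {w₂ = w₂} [] s₂ = ⊩S-cast refl (sym (ℚ.+-identityˡ w₂)) s₂
⊩S-++ {Γ₂ = Γ₂} {w₂ = w₂} (_∷_ {Γ = Γ} {w = w} {Γs = Γs} {ws = ws} v s) s₂ =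
  ⊩S-cast (sym (List.++-assoc Γ Γs Γ₂)) (sym (ℚ.+-assoc w ws w₂)) (v ∷ ⊩S-++ s s₂)

⊩q-scale : ∀ {n p Γ w V q A} → InUnit p → _⊩q[_]_∶_ {n} Γ w V (q , A) →
           scaleO p Γ ⊩q[ p * w ] V ∶ (p * q , A)
⊩q-scale {p = p} p∈ (⊩var q∈ a) = ⊩q-cast refl (sym (ℚ.*-zeroʳ p)) (⊩var (*-inUnit p∈ q∈) a)
⊩q-scale {p = p} p∈ (⊩lam {Γ = Γ} {w = w} {q = q} q∈ d) =
  ⊩q-cast (sym (scaleO-scaleO p q Γ)) (ℚ.*-assoc p q w) (⊩lam (*-inUnit p∈ q∈) d)

⊩S-scale : ∀ {m n σ Δ Γ w p} → InUnit p → _⊩S[_]_∶_ {m} {n} Γ w σ Δ →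
           scaleO p Γ ⊩S[ p * w ] σ ∶ scaleO p Δ
⊩S-scale {p = p} p∈ [] = ⊩S-cast refl (sym (ℚ.*-zeroʳ p)) []
⊩S-scale {p = p} p∈ (_∷_ {Γ = Γ} {w = w} {Γs = Γs} {ws = ws} v s) =
  ⊩S-cast (sym (scaleO-++ p Γ Γs)) (sym (ℚ.*-distribˡ-+ p w ws)) (⊩q-scale p∈ v ∷ ⊩S-scale p∈ s)

-- Substitution under a binder renames the substituted values (exts), so anti-substitution
-- also has to undo renamings of them.
AntiRenamable : ∀ {m n} → (Fin m → Val n) → Set
AntiRenamable {m} {n} σ =
  ∀ (i : Fin m) {l} (ρ : Fin n → Fin l) {Γ w qA} → Γ ⊩q[ w ] renV ρ (σ i) ∶ qA →
  Σ (Occ n) λ Γ₀ → Γ₀ ⊩q[ w ] σ i ∶ qA × Γ ↭ renameO ρ Γ₀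

antiRenamable-exts : ∀ {m n} {σ : Fin m → Val n} → AntiRenamable σ → AntiRenamable (exts σ)
antiRenamable-exts r zero    ρ (⊩var u a) = _ , ⊩var u a , ↭-refl
antiRenamable-exts {σ = σ} r (suc j) ρ {Γ} {w} {qA} v
  with r j (ρ ∘ suc) (subst (λ z → Γ ⊩q[ w ] z ∶ qA) (renV-∘ ρ suc (σ j)) v)
... | Γ₀ , v₀ , p =
  renameO suc Γ₀ , ⊩q-rename suc v₀ , ↭-trans p (↭-reflexive (sym (renameO-∘ ρ suc Γ₀)))

record ExtsSplit {m n} (σ : Fin m → Val n) (Γs : Occ (suc n)) (ws : ℚ) (Δ : Occ (suc m)) : Set where
  constructor split
  field
    𝓝    : Inter
    Δ'   : Occ m
    Γs'  : Occ n
    ws'  : ℚ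
    Δ↭   : Δ ↭ extendO 𝓝 Δ'
    s    : Γs' ⊩S[ ws' ] σ ∶ Δ'
    Γs↭  : Γs ↭ extendO 𝓝 Γs'
    ws≡  : ws ≡ ws'

-- Occurrences of the bound variable are typed by ⊩var and collect into 𝓝; the others type
-- shifted values renV suc (σ j), which anti-renaming pulls back to typings of σ j.
⊩S-exts-split : ∀ {m n} {σ : Fin m → Val n} → AntiRenamable σ → ∀ {Γs ws Δ} →
                Γs ⊩S[ ws ] exts σ ∶ Δ → ExtsSplit σ Γs ws Δ
⊩S-exts-split r [] = split [] [] [] 0ℚ ↭-refl [] ↭-refl refl
⊩S-exts-split r (_∷_ {i = zero} (⊩var u a) s) with ⊩S-exts-split r s
... | split 𝓝 Δ' Γs' ws' p₁ s' p₂ e =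
  split (_ ∷ 𝓝) Δ' Γs' ws' (↭-prep _ p₁) s' (↭-prep _ p₂) (trans (ℚ.+-identityˡ _) e)
⊩S-exts-split r (_∷_ {i = suc j} {qA = qA} {w = w} v s) with ⊩S-exts-split r s | r j suc v
... | split 𝓝 Δ' Γs' ws' p₁ s' p₂ e | Γ₀ , v₀ , q =
  split 𝓝 ((j , qA) ∷ Δ') (Γ₀ ++ Γs') (w + ws')
    (↭-trans (↭-prep _ p₁) (↭-sym (↭.shift _ (zeroO 𝓝) (renameO suc Δ'))))
    (v₀ ∷ s')
    (↭-trans (↭.++⁺ q p₂)
      (↭-trans (↭.shifts (renameO suc Γ₀) (zeroO 𝓝))
               (↭.++⁺ˡ (zeroO 𝓝) (↭-reflexive (sym (renameO-++ suc Γ₀ Γs'))))))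
    (cong (w +_) e)

record AntiSubst {m n} (σ : Fin m → Val n) (J : Occ m → ℚ → Set) (Γ : Occ n) (w : ℚ) : Set where
  constructor antisubst
  field
    Δ  : Occ m
    u  : ℚ
    j  : J Δ u
    Γs : Occ n
    ws : ℚ
    s  : Γs ⊩S[ ws ] σ ∶ Δ
    Γ↭ : Γ ↭ Γs
    w≡ : w ≡ u + ws

antisubst-[] : ∀ {m n} {σ : Fin m → Val n} {J : Occ m → ℚ → Set} → J [] 0ℚ → AntiSubst σ J [] 0ℚ
antisubst-[] j = antisubst [] 0ℚ j [] 0ℚ [] ↭-refl (sym (ℚ.+-identityˡ 0ℚ))

antisubst-pair : ∀ {m n} {σ : Fin m → Val n} {J₁ J₂ K : Occ m → ℚ → Set} {Γ₁ Γ₂ w₁ w₂} →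
                 (∀ {Δ₁ Δ₂ u₁ u₂} → J₁ Δ₁ u₁ → J₂ Δ₂ u₂ → K (Δ₁ ++ Δ₂) (u₁ + u₂)) →
                 AntiSubst σ J₁ Γ₁ w₁ → AntiSubst σ J₂ Γ₂ w₂ → AntiSubst σ K (Γ₁ ++ Γ₂) (w₁ + w₂)
antisubst-pair f (antisubst Δ₁ u₁ j₁ Γs₁ ws₁ s₁ p₁ e₁) (antisubst Δ₂ u₂ j₂ Γs₂ ws₂ s₂ p₂ e₂) =
  antisubst (Δ₁ ++ Δ₂) (u₁ + u₂) (f j₁ j₂) (Γs₁ ++ Γs₂) (ws₁ + ws₂) (⊩S-++ s₁ s₂) (↭.++⁺ p₁ p₂)
    (trans (cong₂ _+_ e₁ e₂)
           (solve 4 (λ a b c d → (a :+ c) :+ (b :+ d) := (a :+ b) :+ (c :+ d)) refl u₁ u₂ ws₁ ws₂))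

mutual
  ⊩q-antisubst : ∀ {m n} {σ : Fin m → Val n} → AntiRenamable σ → ∀ V {Γ w qA} →
                 Γ ⊩q[ w ] subV σ V ∶ qA → AntiSubst σ (λ Δ u → Δ ⊩q[ u ] V ∶ qA) Γ w
  ⊩q-antisubst r (var x) {Γ} {w} {q , A} v =
    antisubst ((x , (q , A)) ∷ []) 0ℚ (⊩var (proj₁ (⊩q-wf v)) (proj₂ (⊩q-wf v))) (Γ ++ []) (w + 0ℚ)
      (v ∷ []) (↭-reflexive (sym (List.++-identityʳ Γ)))
      (sym (trans (ℚ.+-identityˡ _) (ℚ.+-identityʳ w)))
  ⊩q-antisubst r (lam t) (⊩lam {q = q} q∈ (⊩λ wi wd d p)) with ⊩D-antisubst-binder r t d p
  ... | antisubst Δ u (_ , d' , p') Γs ws s Γ↭ e =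
    antisubst (scaleO q Δ) (q * (u + 1ℚ)) (⊩lam q∈ (⊩λ wi wd d' p')) (scaleO q Γs) (q * ws)
      (⊩S-scale q∈ s) (↭.map⁺ _ Γ↭)
      (trans (cong (λ z → q * (z + 1ℚ)) e)
             (solve 3 (λ q u s → q :* ((u :+ s) :+ con 1ℚ) := q :* (u :+ con 1ℚ) :+ q :* s)
                    refl q u ws))

  ⊩I-antisubst : ∀ {m n} {σ : Fin m → Val n} → AntiRenamable σ → ∀ V {Γ w 𝓜} →
                 Γ ⊩I[ w ] subV σ V ∶ 𝓜 → AntiSubst σ (λ Δ u → Δ ⊩I[ u ] V ∶ 𝓜) Γ w
  ⊩I-antisubst r V []      = antisubst-[] []
  ⊩I-antisubst r V (v ∷ i) = antisubst-pair _∷_ (⊩q-antisubst r V v) (⊩I-antisubst r V i)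

  ⊩D-antisubst : ∀ {m n} {σ : Fin m → Val n} → AntiRenamable σ → ∀ M {Γ w a} →
                 Γ ⊩D[ w ] subT σ M ∶ a → AntiSubst σ (λ Δ u → Δ ⊩D[ u ] M ∶ a) Γ w
  ⊩D-antisubst r (val V)     ⊩zero = antisubst-[] ⊩zero
  ⊩D-antisubst r (app V W)   ⊩zero = antisubst-[] ⊩zero
  ⊩D-antisubst r (M ⊕ N)     ⊩zero = antisubst-[] ⊩zero
  ⊩D-antisubst r (letin N M) ⊩zero = antisubst-[] ⊩zero
  ⊩D-antisubst r (val V) (⊩val i) with ⊩I-antisubst r V i
  ... | antisubst Δ u j Γs ws s p e = antisubst Δ u (⊩val j) Γs ws s p e
  ⊩D-antisubst r (app V W) (⊩app i₁ i₂) =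
    antisubst-pair ⊩app (⊩I-antisubst r V i₁) (⊩I-antisubst r W i₂)
  ⊩D-antisubst r (M ⊕ N) (⊩⊕ d₁ d₂) with ⊩D-antisubst r M d₁ | ⊩D-antisubst r N d₂
  ... | antisubst Δ₁ u₁ j₁ Γs₁ ws₁ s₁ p₁ e₁ | antisubst Δ₂ u₂ j₂ Γs₂ ws₂ s₂ p₂ e₂ =
    antisubst (scaleO ½ Δ₁ ++ scaleO ½ Δ₂) (½ * u₁ + ½ * u₂ + 1ℚ) (⊩⊕ j₁ j₂)
      (scaleO ½ Γs₁ ++ scaleO ½ Γs₂) (½ * ws₁ + ½ * ws₂)
      (⊩S-++ (⊩S-scale ½-inUnit s₁) (⊩S-scale ½-inUnit s₂)) (↭.++⁺ (↭.map⁺ _ p₁) (↭.map⁺ _ p₂))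
      (trans (cong₂ (λ x y → ½ * x + ½ * y + 1ℚ) e₁ e₂)
             (solve 4 (λ a b c d → con ½ :* (a :+ c) :+ con ½ :* (b :+ d) :+ con 1ℚ
                                := (con ½ :* a :+ con ½ :* b :+ con 1ℚ) :+ (con ½ :* c :+ con ½ :* d))
                    refl u₁ u₂ ws₁ ws₂))
  ⊩D-antisubst r (letin N M) (⊩let d f) with ⊩D-antisubst r N d | ⊩F-antisubst r M f
  ... | antisubst Δ₁ u₁ j₁ Γs₁ ws₁ s₁ p₁ e₁ | antisubst Δ₂ u₂ j₂ Γs₂ ws₂ s₂ p₂ e₂ =
    antisubst (Δ₁ ++ Δ₂) (u₂ + u₁ + 1ℚ) (⊩let j₁ j₂) (Γs₁ ++ Γs₂) (ws₁ + ws₂) (⊩S-++ s₁ s₂)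
      (↭.++⁺ p₁ p₂)
      (trans (cong₂ (λ x y → x + y + 1ℚ) e₂ e₁)
             (solve 4 (λ a b c d → (a :+ c) :+ (b :+ d) :+ con 1ℚ := (a :+ b :+ con 1ℚ) :+ (d :+ c))
                    refl u₂ u₁ ws₂ ws₁))

  ⊩F-antisubst : ∀ {m n} {σ : Fin m → Val n} → AntiRenamable σ → ∀ M {Γ w a b} →
                 Γ ⊩F[ w ] subT (exts σ) M ∶ a ↦ b → AntiSubst σ (λ Δ u → Δ ⊩F[ u ] M ∶ a ↦ b) Γ w
  ⊩F-antisubst r M [] = antisubst-[] []
  ⊩F-antisubst r M (cons {p = p} p∈ d q f) with ⊩D-antisubst-binder r M d q | ⊩F-antisubst r M f
  ... | antisubst Δ u (_ , d' , q') Γs ws s Γ↭ e | antisubst Δᶠ uᶠ jᶠ Γsᶠ wsᶠ sᶠ Γᶠ↭ eᶠ =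
    antisubst (scaleO p Δ ++ Δᶠ) (p * u + uᶠ) (cons p∈ d' q' jᶠ) (scaleO p Γs ++ Γsᶠ) (p * ws + wsᶠ)
      (⊩S-++ (⊩S-scale p∈ s) sᶠ) (↭.++⁺ (↭.map⁺ _ Γ↭) Γᶠ↭)
      (trans (cong₂ (λ x y → p * x + y) e eᶠ)
             (solve 5 (λ p a b c d → p :* (a :+ b) :+ (c :+ d) := (p :* a :+ c) :+ (p :* b :+ d))
                    refl p u ws uᶠ wsᶠ))

  ⊩D-antisubst-binder : ∀ {m n} {σ : Fin m → Val n} → AntiRenamable σ → ∀ M {Θ Γ w 𝓜 b} →
                        Θ ⊩D[ w ] subT (exts σ) M ∶ b → Θ ↭ extendO 𝓜 Γ →
                        AntiSubst σ (λ Δ u → Σ (Occ (suc m)) λ Θ' → Θ' ⊩D[ u ] M ∶ b × Θ' ↭ extendO 𝓜 Δ)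
                                  Γ w
  ⊩D-antisubst-binder r M d p with ⊩D-antisubst (antiRenamable-exts r) M d
  ... | antisubst Θ' u d' Θs ws s Θ↭ e with ⊩S-exts-split r s
  ... | split 𝓝 Δ Γs ws' Θ'↭ s' Θs↭ e' =
    let 𝓜↭𝓝 , Γ↭Γs = extendO-↭-inv (↭-trans (↭-sym p) (↭-trans Θ↭ Θs↭))
    in antisubst Δ u (Θ' , d' , ↭-trans Θ'↭ (extendO-↭ˡ Δ (↭-sym 𝓜↭𝓝))) Γs ws' s' Γ↭Γs
         (trans e (cong (u +_) e'))

antiRenamable-var : ∀ {m n} (ρ : Fin m → Fin n) → AntiRenamable (var ∘ ρ)
antiRenamable-var ρ i ρ' (⊩var u a) = _ , ⊩var u a , ↭-refl

⊩S-var-inv : ∀ {m n} {ρ : Fin m → Fin n} {Δ Γ w} → Γ ⊩S[ w ] var ∘ ρ ∶ Δ → Γ ≡ renameO ρ Δ × w ≡ 0ℚ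
⊩S-var-inv [] = refl , refl
⊩S-var-inv (⊩var u a ∷ s) with ⊩S-var-inv s
... | refl , refl = refl , ℚ.+-identityˡ 0ℚ

-- Renaming is substitution by variables, and variables are trivially anti-renamable.
⊩q-antirename : ∀ {m n} V (ρ : Fin m → Fin n) {Γ w qA} → Γ ⊩q[ w ] renV ρ V ∶ qA →
                Σ (Occ m) λ Γ₀ → Γ₀ ⊩q[ w ] V ∶ qA × Γ ↭ renameO ρ Γ₀
⊩q-antirename V ρ {Γ} {w} {qA} v
  with ⊩q-antisubst (antiRenamable-var ρ) V (subst (λ z → Γ ⊩q[ w ] z ∶ qA) (renV-as-subV ρ V) v)
... | antisubst Δ u j Γs ws s p e with ⊩S-var-inv s
... | refl , refl = Δ , ⊩q-cast refl (sym (trans e (ℚ.+-identityʳ u))) j , p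

antiRenamable-closed : ∀ {n} (σ : Fin n → Val 0) → AntiRenamable σ
antiRenamable-closed σ i ρ v = ⊩q-antirename (σ i) ρ v

inUnit⇒nonNeg : ∀ {p} → InUnit p → NonNegative p
inUnit⇒nonNeg {p} p∈ = ℚ.pos⇒nonNeg p {{positive (proj₁ p∈)}}

norm-scaleD : ∀ p a → norm (scaleD p a) ≡ p * norm a
norm-scaleD p [] = sym (ℚ.*-zeroʳ p)
norm-scaleD p ((q , _) ∷ a) =
  trans (cong (p * q +_) (norm-scaleD p a)) (sym (ℚ.*-distribˡ-+ p q (norm a)))

norm-++ : ∀ a b → norm (a ++ b) ≡ norm a + norm b
norm-++ [] b = sym (ℚ.+-identityˡ (norm b))
norm-++ ((q , _) ∷ a) b = trans (cong (q +_) (norm-++ a b)) (sym (ℚ.+-assoc q (norm a) (norm b)))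

scaleD-scaleD : ∀ p q a → scaleD p (scaleD q a) ≡ scaleD (p * q) a
scaleD-scaleD p q [] = refl
scaleD-scaleD p q ((r , 𝓜) ∷ a) = cong₂ _∷_ (cong (_, 𝓜) (sym (ℚ.*-assoc p q r))) (scaleD-scaleD p q a)

scaleD-1ℚ : ∀ a → scaleD 1ℚ a ≡ a
scaleD-1ℚ [] = refl
scaleD-1ℚ ((p , 𝓜) ∷ a) = cong₂ _∷_ (cong (_, 𝓜) (ℚ.*-identityˡ p)) (scaleD-1ℚ a)

WFDe-scaleD : ∀ {p a} → InUnit p → WFDe a → WFDe (scaleD p a)
WFDe-scaleD p∈ [] = []
WFDe-scaleD p∈ ((q∈ , wi) ∷ w) = (*-inUnit p∈ q∈ , wi) ∷ WFDe-scaleD p∈ w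

WFDe-++ : ∀ {a b} → WFDe a → WFDe b → WFDe (a ++ b)
WFDe-++ [] wb = wb
WFDe-++ (x ∷ wa) wb = x ∷ WFDe-++ wa wb

½*+½*≤1 : ∀ {x y} → x ≤ 1ℚ → y ≤ 1ℚ → ½ * x + ½ * y ≤ 1ℚ
½*+½*≤1 hx hy = ℚ.+-mono-≤ (ℚ.*-monoˡ-≤-nonNeg ½ hx) (ℚ.*-monoˡ-≤-nonNeg ½ hy)

⊩I-wf : ∀ {n Γ w V 𝓜} → _⊩I[_]_∶_ {n} Γ w V 𝓜 → WFI 𝓜
⊩I-wf []      = []
⊩I-wf (v ∷ i) = ⊩q-wf v ∷ ⊩I-wf i

mutual
  ⊩D-wf : ∀ {n Γ w M a} → _⊩D[_]_∶_ {n} Γ w M a → WFD a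
  ⊩D-wf ⊩zero = [] , ℚ.≤ᵇ⇒≤ _
  ⊩D-wf (⊩val i) = ((1-inUnit , ⊩I-wf i) ∷ []) , ℚ.≤ᵇ⇒≤ _
  ⊩D-wf (⊩app (v ∷ []) _) with ⊩q-wf v
  ... | _ , wf⇒ _ wd = wd
  ⊩D-wf (⊩⊕ {a = a} {b = b} d₁ d₂) with ⊩D-wf d₁ | ⊩D-wf d₂
  ... | w₁ , n₁ | w₂ , n₂ =
    WFDe-++ (WFDe-scaleD ½-inUnit w₁) (WFDe-scaleD ½-inUnit w₂) ,
    ℚ.≤-trans (ℚ.≤-reflexive (trans (norm-++ (scaleD ½ a) (scaleD ½ b))
                                    (cong₂ _+_ (norm-scaleD ½ a) (norm-scaleD ½ b))))
              (½*+½*≤1 n₁ n₂)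
  ⊩D-wf (⊩let d f) with ⊩D-wf d
  ... | wc , nc with ⊩F-wf wc f
  ... | wb , nb = wb , ℚ.≤-trans nb nc

  ⊩F-wf : ∀ {n Γ w M a b} → WFDe a → _⊩F[_]_∶_↦_ {n} Γ w M a b → WFDe b × norm b ≤ norm a
  ⊩F-wf [] [] = [] , ℚ.≤-refl
  ⊩F-wf (_ ∷ wa) (cons {b = b} {p = p} {a = a} {bs = bs} p∈ d _ f) with ⊩D-wf d | ⊩F-wf wa f
  ... | w₀ , n₀ | wr , nr =
    WFDe-++ (WFDe-scaleD p∈ w₀) wr ,
    (begin
      norm (scaleD p b ++ bs) ≡⟨ trans (norm-++ (scaleD p b) bs) (cong (_+ norm bs) (norm-scaleD p b)) ⟩
      p * norm b + norm bs    ≤⟨ ℚ.+-mono-≤ (ℚ.*-monoˡ-≤-nonNeg p {{inUnit⇒nonNeg p∈}} n₀) nr ⟩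
      p * 1ℚ + norm a         ≡⟨ cong (_+ norm a) (ℚ.*-identityʳ p) ⟩
      p + norm a              ∎)
    where open ℚ.≤-Reasoning

Occ0-[] : (Γ : Occ 0) → Γ ≡ []
Occ0-[] [] = refl
Occ0-[] ((() , _) ∷ _)

Occ1-extendO : (Δ : Occ 1) → Δ ≡ extendO (mapMaybe zeroPart Δ) []
Occ1-extendO [] = refl
Occ1-extendO ((zero , qA) ∷ Δ) = cong (_ ∷_) (Occ1-extendO Δ)
Occ1-extendO ((suc () , _) ∷ Δ)

⊩S₁⇒⊩I : ∀ {σ : Fin 1 → Val 0} {Γs ws Δ} → Γs ⊩S[ ws ] σ ∶ Δ → Γs ⊩I[ ws ] σ zero ∶ mapMaybe zeroPart Δ
⊩S₁⇒⊩I [] = []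
⊩S₁⇒⊩I (_∷_ {i = zero} v s) = v ∷ ⊩S₁⇒⊩I s

⊩D-antisubst₀ : ∀ B W {w a} → [] ⊩D[ w ] B [ W /0] ∶ a →
                Σ Inter λ 𝓝 → Σ ℚ λ u → Σ ℚ λ ws →
                extendO 𝓝 [] ⊩D[ u ] B ∶ a × [] ⊩I[ ws ] W ∶ 𝓝 × w ≡ u + ws
⊩D-antisubst₀ B W d with ⊩D-antisubst (antiRenamable-closed _) B d
... | antisubst Δ u j Γs ws s _ e with Occ0-[] Γs
... | refl = mapMaybe zeroPart Δ , u , ws , ⊩D-cast (Occ1-extendO Δ) refl j , ⊩S₁⇒⊩I s , e

⊩F-scale : ∀ {n Γ w M a b p} → InUnit p → _⊩F[_]_∶_↦_ {n} Γ w M a b →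
           scaleO p Γ ⊩F[ p * w ] M ∶ scaleD p a ↦ scaleD p b
⊩F-scale {p = p} p∈ [] = ⊩F-cast refl (sym (ℚ.*-zeroʳ p)) refl []
⊩F-scale {p = p} p∈ (cons {Δ = Δ} {w = w} {b = b} {p = p'} {Δs = Δs} {ws = ws} {bs = bs} p'∈ d q f) =
  ⊩F-cast (trans (cong (_++ _) (sym (scaleO-scaleO p p' Δ))) (sym (scaleO-++ p (scaleO p' Δ) Δs)))
          (solve 4 (λ p p' w ws → (p :* p') :* w :+ p :* ws := p :* (p' :* w :+ ws)) refl p p' w ws)
          (trans (cong (_++ _) (sym (scaleD-scaleD p p' b))) (sym (List.map-++ _ (scaleD p' b) bs)))
          (cons (*-inUnit p∈ p'∈) d q (⊩F-scale p∈ f))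

⊩F-++ : ∀ {n M a₁ Γ₁ w₁ b₁ a₂ Γ₂ w₂ b₂} → _⊩F[_]_∶_↦_ {n} Γ₁ w₁ M a₁ b₁ → Γ₂ ⊩F[ w₂ ] M ∶ a₂ ↦ b₂ →
        Γ₁ ++ Γ₂ ⊩F[ w₁ + w₂ ] M ∶ a₁ ++ a₂ ↦ b₁ ++ b₂
⊩F-++ {w₂ = w₂} [] f₂ = ⊩F-cast refl (sym (ℚ.+-identityˡ w₂)) refl f₂
⊩F-++ {Γ₂ = Γ₂} {w₂ = w₂} {b₂ = b₂}
      (cons {Δ = Δ} {w = w} {b = b} {p = p} {Δs = Δs} {ws = ws} {bs = bs} u d q f) f₂ =
  ⊩F-cast (sym (List.++-assoc (scaleO p Δ) Δs Γ₂)) (sym (ℚ.+-assoc (p * w) ws w₂))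
          (sym (List.++-assoc (scaleD p b) bs b₂)) (cons u d q (⊩F-++ f f₂))

NonVal : Tm 0 → Set
NonVal (val _) = ⊥
NonVal _       = ⊤

mass : MDist → ℚ
mass L = sumℚ (map proj₁ L)

infix 4 ⊩M[_]_∶_

data ⊩M[_]_∶_ : ℚ → MDist → TDist → Set where
  []  : ⊩M[ 0ℚ ] [] ∶ []
  _∷_ : ∀ {p N a w L b v} → [] ⊩D[ w ] N ∶ a → ⊩M[ v ] L ∶ b →
        ⊩M[ p * w + v ] (p , N) ∷ L ∶ scaleD p a ++ b

letMap : Tm 1 → MDist → MDist
letMap B = map (λ pN → (proj₁ pN , letin (proj₂ pN) B))

mass-letMap : ∀ B L → mass (letMap B L) ≡ mass L
mass-letMap B [] = refl
mass-letMap B (x ∷ L) = cong (proj₁ x +_) (mass-letMap B L)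

letMap-inUnit : ∀ B {L} → All (InUnit ∘ proj₁) L → All (InUnit ∘ proj₁) (letMap B L)
letMap-inUnit B = All.map⁺

liftTerm-inUnit : ∀ N → NonVal N → All (InUnit ∘ proj₁) (liftTerm N)
liftTerm-inUnit (app (var ()) W) _
liftTerm-inUnit (app (lam B) W) _ = 1-inUnit ∷ []
liftTerm-inUnit (M ⊕ N) _ = ½-inUnit ∷ ½-inUnit ∷ []
liftTerm-inUnit (letin (val V) B) _ = 1-inUnit ∷ []
liftTerm-inUnit (letin (app V W) B) _ = letMap-inUnit B (liftTerm-inUnit (app V W) tt)
liftTerm-inUnit (letin (N₁ ⊕ N₂) B) _ = letMap-inUnit B (liftTerm-inUnit (N₁ ⊕ N₂) tt)
liftTerm-inUnit (letin (letin N₁ B₁) B) _ = letMap-inUnit B (liftTerm-inUnit (letin N₁ B₁) tt)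

mass-liftTerm : ∀ N → NonVal N → mass (liftTerm N) ≡ 1ℚ
mass-liftTerm (app (var ()) W) _
mass-liftTerm (app (lam B) W) _ = ℚ.+-identityʳ 1ℚ
mass-liftTerm (M ⊕ N) _ = refl
mass-liftTerm (letin (val V) B) _ = ℚ.+-identityʳ 1ℚ
mass-liftTerm (letin (app V W) B) _ =
  trans (mass-letMap B (liftTerm (app V W))) (mass-liftTerm (app V W) tt)
mass-liftTerm (letin (N₁ ⊕ N₂) B) _ =
  trans (mass-letMap B (liftTerm (N₁ ⊕ N₂))) (mass-liftTerm (N₁ ⊕ N₂) tt)
mass-liftTerm (letin (letin N₁ B₁) B) _ =
  trans (mass-letMap B (liftTerm (letin N₁ B₁))) (mass-liftTerm (letin N₁ B₁) tt)

⊩D-letin-inv : ∀ {Γ : Occ 0} {w N B a} → Γ ⊩D[ w ] letin N B ∶ a →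
               Σ TDist λ c → Σ ℚ λ v → Σ ℚ λ ws →
               [] ⊩D[ v ] N ∶ c × [] ⊩F[ ws ] B ∶ c ↦ a × w ≤ ws + v + 1ℚ
⊩D-letin-inv ⊩zero = [] , 0ℚ , 0ℚ , ⊩zero , [] , ℚ.≤ᵇ⇒≤ _
⊩D-letin-inv (⊩let {Γ = Γ} {Δ = Δ} d f) with Occ0-[] Γ | Occ0-[] Δ
... | refl | refl = _ , _ , _ , d , f , ℚ.≤-refl

-- Each component's let-rule costs 1, weighted by its probability: hence the term mass L.
⊩M-letMap-inv : ∀ B L {b v} → All (InUnit ∘ proj₁) L → ⊩M[ v ] letMap B L ∶ b →
                Σ TDist λ c → Σ ℚ λ v' → Σ ℚ λ ws →
                ⊩M[ v' ] L ∶ c × [] ⊩F[ ws ] B ∶ c ↦ b × v ≤ ws + v' + mass L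
⊩M-letMap-inv B [] [] [] = [] , 0ℚ , 0ℚ , [] , [] , ℚ.≤ᵇ⇒≤ _
⊩M-letMap-inv B ((p , N) ∷ L) (p∈ ∷ p∈s) (_∷_ {w = w} {v = v} d ds)
  with ⊩D-letin-inv d | ⊩M-letMap-inv B L p∈s ds
... | c , v₁ , ws₁ , d₁ , f₁ , h | C , V , WS , ds' , F , h' =
  scaleD p c ++ C , p * v₁ + V , p * ws₁ + WS , d₁ ∷ ds' , ⊩F-++ (⊩F-scale p∈ f₁) F ,
  (begin
    p * w + v                               ≤⟨ ℚ.+-mono-≤ (ℚ.*-monoˡ-≤-nonNeg p {{inUnit⇒nonNeg p∈}} h) h' ⟩
    p * (ws₁ + v₁ + 1ℚ) + (WS + V + mass L) ≡⟨ rearrange p ws₁ v₁ WS V (mass L) ⟩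
    (p * ws₁ + WS) + (p * v₁ + V) + (p + mass L) ∎)
  where
  open ℚ.≤-Reasoning
  rearrange : ∀ p a b c d e → p * (a + b + 1ℚ) + (c + d + e) ≡ (p * a + c) + (p * b + d) + (p + e)
  rearrange = solve 6 (λ p a b c d e → p :* (a :+ b :+ con 1ℚ) :+ (c :+ d :+ e)
                                    := (p :* a :+ c) :+ (p :* b :+ d) :+ (p :+ e)) refl

mutual
  ⊩D-expand : ∀ M → NonVal M → ∀ {b v} → ⊩M[ v ] liftTerm M ∶ b →
              Σ ℚ λ w → [] ⊩D[ w ] M ∶ b × 1ℚ + v ≤ w
  ⊩D-expand (app (var ()) W) _ _
  ⊩D-expand (app (lam B) W) _ (_∷_ {a = a} d []) with ⊩D-antisubst₀ B W d
  ... | 𝓝 , u , ws , ⊩B , ⊩W , e =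
    _ , subst ([] ⊩D[ _ ] app (lam B) W ∶_) (sym (trans (List.++-identityʳ _) (scaleD-1ℚ a)))
              (⊩app (⊩lam 1-inUnit (⊩λ (⊩I-wf ⊩W) (⊩D-wf d) ⊩B ↭-refl) ∷ []) ⊩W) ,
    ℚ.≤-reflexive (trans (cong (λ z → 1ℚ + (1ℚ * z + 0ℚ)) e)
                         (solve 2 (λ u ws → con 1ℚ :+ (con 1ℚ :* (u :+ ws) :+ con 0ℚ)
                                          := (con 1ℚ :* (u :+ con 1ℚ) :+ con 0ℚ) :+ ws) refl u ws))
  ⊩D-expand (M ⊕ N) _ (_∷_ {w = w₁} d₁ (_∷_ {a = a₂} {w = w₂} d₂ [])) =
    _ , subst (_ ⊩D[ _ ] M ⊕ N ∶_) (cong (_ ++_) (sym (List.++-identityʳ (scaleD ½ a₂)))) (⊩⊕ d₁ d₂) ,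
    ℚ.≤-reflexive (solve 2 (λ a b → con 1ℚ :+ (con ½ :* a :+ (con ½ :* b :+ con 0ℚ))
                                  := con ½ :* a :+ con ½ :* b :+ con 1ℚ) refl w₁ w₂)
  ⊩D-expand (letin (val V) B) _ (d ∷ []) with ⊩D-antisubst₀ B V d
  ... | 𝓝 , u , ws , ⊩B , ⊩V , e =
    _ , ⊩let (⊩val ⊩V) (cons 1-inUnit ⊩B ↭-refl []) ,
    ℚ.≤-reflexive (trans (cong (λ z → 1ℚ + (1ℚ * z + 0ℚ)) e)
                         (solve 2 (λ u ws → con 1ℚ :+ (con 1ℚ :* (u :+ ws) :+ con 0ℚ)
                                          := (con 1ℚ :* u :+ con 0ℚ) :+ ws :+ con 1ℚ) refl u ws))
  ⊩D-expand (letin (app V W) B) _ ds = ⊩D-expand-letin (app V W) tt B ds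
  ⊩D-expand (letin (N₁ ⊕ N₂) B) _ ds = ⊩D-expand-letin (N₁ ⊕ N₂) tt B ds
  ⊩D-expand (letin (letin N₁ B₁) B) _ ds = ⊩D-expand-letin (letin N₁ B₁) tt B ds

  ⊩D-expand-letin : ∀ N → NonVal N → ∀ B {b v} → ⊩M[ v ] letMap B (liftTerm N) ∶ b →
                    Σ ℚ λ w → [] ⊩D[ w ] letin N B ∶ b × 1ℚ + v ≤ w
  ⊩D-expand-letin N nv B {v = v} ds with ⊩M-letMap-inv B (liftTerm N) (liftTerm-inUnit N nv) ds
  ... | C , V , WS , dsN , F , h with ⊩D-expand N nv dsN
  ... | w , dN , h' =
    WS + w + 1ℚ , ⊩let dN F ,
    (begin
      1ℚ + v                                 ≤⟨ ℚ.+-monoʳ-≤ 1ℚ h ⟩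
      1ℚ + (WS + V + mass (liftTerm N))      ≡⟨ cong (λ z → 1ℚ + (WS + V + z)) (mass-liftTerm N nv) ⟩
      1ℚ + (WS + V + 1ℚ)                     ≡⟨ solve 2 (λ a b → con 1ℚ :+ (a :+ b :+ con 1ℚ)
                                                              := a :+ (con 1ℚ :+ b) :+ con 1ℚ) refl WS V ⟩
      WS + (1ℚ + V) + 1ℚ                     ≤⟨ ℚ.+-monoˡ-≤ 1ℚ (ℚ.+-monoʳ-≤ WS h') ⟩
      WS + w + 1ℚ                            ∎)
    where open ℚ.≤-Reasoning

steps : ℕ → MDist → MDist
steps zero    m = m
steps (suc k) m = liftStep (steps k m)

valueMass : MDist → ℚ
valueMass m = sumℚ (map isValueProb m)

expect : (Tm 0 → ℚ) → MDist → ℚ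
expect f L = sumℚ (map (λ pN → proj₁ pN * f (proj₂ pN)) L)

mdist≡steps : ∀ k M → mdist k M ≡ steps k [ (1ℚ , M) ]
mdist≡steps zero    M = refl
mdist≡steps (suc k) M = cong liftStep (mdist≡steps k M)

steps-suc : ∀ k m → steps (suc k) m ≡ steps k (liftStep m)
steps-suc zero    m = refl
steps-suc (suc k) m = cong liftStep (steps-suc k m)

liftStep-++ : ∀ m₁ m₂ → liftStep (m₁ ++ m₂) ≡ liftStep m₁ ++ liftStep m₂
liftStep-++ [] m₂ = refl
liftStep-++ ((p , N) ∷ m₁) m₂ =
  trans (cong (_ ++_) (liftStep-++ m₁ m₂)) (sym (List.++-assoc (scaleM p (liftTerm N)) _ _))

steps-++ : ∀ k m₁ m₂ → steps k (m₁ ++ m₂) ≡ steps k m₁ ++ steps k m₂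
steps-++ zero    m₁ m₂ = refl
steps-++ (suc k) m₁ m₂ =
  trans (cong liftStep (steps-++ k m₁ m₂)) (liftStep-++ (steps k m₁) (steps k m₂))

scaleM-scaleM : ∀ p q m → scaleM p (scaleM q m) ≡ scaleM (p * q) m
scaleM-scaleM p q [] = refl
scaleM-scaleM p q ((r , N) ∷ m) = cong₂ _∷_ (cong (_, N) (sym (ℚ.*-assoc p q r))) (scaleM-scaleM p q m)

scaleM-1ℚ : ∀ m → scaleM 1ℚ m ≡ m
scaleM-1ℚ [] = refl
scaleM-1ℚ ((p , N) ∷ m) = cong₂ _∷_ (cong (_, N) (ℚ.*-identityˡ p)) (scaleM-1ℚ m)

liftStep-scaleM : ∀ p m → liftStep (scaleM p m) ≡ scaleM p (liftStep m)
liftStep-scaleM p [] = refl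
liftStep-scaleM p ((q , N) ∷ m) =
  trans (cong₂ _++_ (sym (scaleM-scaleM p q (liftTerm N))) (liftStep-scaleM p m))
        (sym (List.map-++ _ (scaleM q (liftTerm N)) (liftStep m)))

steps-scaleM : ∀ k p m → steps k (scaleM p m) ≡ scaleM p (steps k m)
steps-scaleM zero    p m = refl
steps-scaleM (suc k) p m = trans (cong liftStep (steps-scaleM k p m)) (liftStep-scaleM p (steps k m))

steps-[] : ∀ k → steps k [] ≡ []
steps-[] zero    = refl
steps-[] (suc k) = cong liftStep (steps-[] k)

valueMass-++ : ∀ m₁ m₂ → valueMass (m₁ ++ m₂) ≡ valueMass m₁ + valueMass m₂
valueMass-++ [] m₂ = sym (ℚ.+-identityˡ _)
valueMass-++ (x ∷ m₁) m₂ =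
  trans (cong (isValueProb x +_) (valueMass-++ m₁ m₂)) (sym (ℚ.+-assoc (isValueProb x) _ _))

isValueProb-scale : ∀ p x → isValueProb (p * proj₁ x , proj₂ x) ≡ p * isValueProb x
isValueProb-scale p (q , val V)     = refl
isValueProb-scale p (q , app V W)   = sym (ℚ.*-zeroʳ p)
isValueProb-scale p (q , M ⊕ N)     = sym (ℚ.*-zeroʳ p)
isValueProb-scale p (q , letin N M) = sym (ℚ.*-zeroʳ p)

valueMass-scaleM : ∀ p m → valueMass (scaleM p m) ≡ p * valueMass m
valueMass-scaleM p [] = sym (ℚ.*-zeroʳ p)
valueMass-scaleM p (x ∷ m) =
  trans (cong₂ _+_ (isValueProb-scale p x) (valueMass-scaleM p m)) (sym (ℚ.*-distribˡ-+ p _ _))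

valueMass-steps-[_] : ∀ k p N → valueMass (steps k [ (p , N) ]) ≡ p * Prob k N
valueMass-steps-[_] k p N = begin
  valueMass (steps k [ (p , N) ])
    ≡⟨ cong (λ z → valueMass (steps k [ (z , N) ])) (sym (ℚ.*-identityʳ p)) ⟩
  valueMass (steps k (scaleM p [ (1ℚ , N) ]))
    ≡⟨ cong valueMass (steps-scaleM k p _) ⟩
  valueMass (scaleM p (steps k [ (1ℚ , N) ]))
    ≡⟨ valueMass-scaleM p (steps k [ (1ℚ , N) ]) ⟩
  p * valueMass (steps k [ (1ℚ , N) ])
    ≡⟨ cong (λ z → p * valueMass z) (sym (mdist≡steps k N)) ⟩
  p * Prob k N ∎
  where open ≡-Reasoning

valueMass-steps : ∀ k L → valueMass (steps k L) ≡ expect (Prob k) L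
valueMass-steps k [] = cong valueMass (steps-[] k)
valueMass-steps k ((p , N) ∷ L) = begin
  valueMass (steps k ([ (p , N) ] ++ L))
    ≡⟨ cong valueMass (steps-++ k [ (p , N) ] L) ⟩
  valueMass (steps k [ (p , N) ] ++ steps k L)
    ≡⟨ valueMass-++ (steps k [ (p , N) ]) (steps k L) ⟩
  valueMass (steps k [ (p , N) ]) + valueMass (steps k L)
    ≡⟨ cong₂ _+_ (valueMass-steps-[ k ] p N) (valueMass-steps k L) ⟩
  p * Prob k N + expect (Prob k) L ∎
  where open ≡-Reasoning

Prob-suc : ∀ k M → Prob (suc k) M ≡ expect (Prob k) (liftTerm M)
Prob-suc k M = begin
  valueMass (liftStep (mdist k M))
    ≡⟨ cong (valueMass ∘ liftStep) (mdist≡steps k M) ⟩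
  valueMass (steps (suc k) [ (1ℚ , M) ])
    ≡⟨ cong valueMass (steps-suc k _) ⟩
  valueMass (steps k (scaleM 1ℚ (liftTerm M) ++ []))
    ≡⟨ cong (valueMass ∘ steps k) (trans (List.++-identityʳ _) (scaleM-1ℚ _)) ⟩
  valueMass (steps k (liftTerm M))
    ≡⟨ valueMass-steps k (liftTerm M) ⟩
  expect (Prob k) (liftTerm M) ∎
  where open ≡-Reasoning

Prob-zero-nonVal : ∀ M → NonVal M → Prob 0 M ≡ 0ℚ
Prob-zero-nonVal (app V W)   _ = refl
Prob-zero-nonVal (M ⊕ N)     _ = refl
Prob-zero-nonVal (letin N M) _ = refl

expect-0 : ∀ L → expect (λ _ → 0ℚ) L ≡ 0ℚ
expect-0 [] = refl
expect-0 ((p , N) ∷ L) = trans (cong₂ _+_ (ℚ.*-zeroʳ p) (expect-0 L)) (ℚ.+-identityˡ 0ℚ)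

expect-affine : ∀ f g L → expect (λ N → f N + (1ℚ - g N)) L ≡ expect f L + (mass L - expect g L)
expect-affine f g [] = refl
expect-affine f g ((p , N) ∷ L) =
  trans (cong (p * (f N + (1ℚ - g N)) +_) (expect-affine f g L))
        (solve 6 (λ p a b c d e → p :* (a :+ (con 1ℚ :- b)) :+ (c :+ (d :- e))
                               := (p :* a :+ c) :+ ((p :+ d) :- (p :* b :+ e))) refl
               p (f N) (g N) (expect f L) (mass L) (expect g L))

Exp-suc-nonVal : ∀ k M → NonVal M → Exp (suc k) M ≡ 1ℚ + expect (Exp k) (liftTerm M)
Exp-suc-nonVal zero M nv = begin
  0ℚ + (1ℚ - Prob 0 M)                ≡⟨ cong (λ z → 0ℚ + (1ℚ - z)) (Prob-zero-nonVal M nv) ⟩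
  1ℚ                                  ≡⟨ sym (ℚ.+-identityʳ 1ℚ) ⟩
  1ℚ + 0ℚ                             ≡⟨ cong (1ℚ +_) (sym (expect-0 (liftTerm M))) ⟩
  1ℚ + expect (Exp 0) (liftTerm M)    ∎
  where open ≡-Reasoning
Exp-suc-nonVal (suc k) M nv = begin
  Exp (suc k) M + (1ℚ - Prob (suc k) M)
    ≡⟨ cong₂ (λ x y → x + (1ℚ - y)) (Exp-suc-nonVal k M nv) (Prob-suc k M) ⟩
  (1ℚ + expect (Exp k) L) + (1ℚ - expect (Prob k) L)
    ≡⟨ solve 2 (λ a b → (con 1ℚ :+ a) :+ (con 1ℚ :- b) := con 1ℚ :+ (a :+ (con 1ℚ :- b))) refl
                 (expect (Exp k) L) (expect (Prob k) L) ⟩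
  1ℚ + (expect (Exp k) L + (1ℚ - expect (Prob k) L))
    ≡⟨ cong (λ z → 1ℚ + (expect (Exp k) L + (z - expect (Prob k) L))) (sym (mass-liftTerm M nv)) ⟩
  1ℚ + (expect (Exp k) L + (mass L - expect (Prob k) L))
    ≡⟨ cong (1ℚ +_) (sym (expect-affine (Exp k) (Prob k) L)) ⟩
  1ℚ + expect (Exp (suc k)) L ∎
  where
  open ≡-Reasoning
  L = liftTerm M

mdist-val : ∀ k V → mdist k (val V) ≡ [ (1ℚ , val V) ]
mdist-val zero    V = refl
mdist-val (suc k) V =
  trans (cong liftStep (mdist-val k V)) (cong (λ z → (z , val V) ∷ []) (ℚ.*-identityˡ 1ℚ))

Prob-val : ∀ k V → Prob k (val V) ≡ 1ℚ + 0ℚ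
Prob-val k V = cong valueMass (mdist-val k V)

Exp-val : ∀ k V → Exp k (val V) ≡ 0ℚ
Exp-val zero    V = refl
Exp-val (suc k) V = cong₂ (λ x y → x + (1ℚ - y)) (Exp-val k V) (Prob-val k V)

TightBound : ℕ → Tm 0 → Set
TightBound k M = Σ ℚ λ w → Σ TDist λ a → Tight a × [] ⊩D[ w ] M ∶ a × norm a ≡ Prob k M × Exp k M ≤ w

mutual
  tightBound : ∀ k M → TightBound k M
  tightBound k (val V) =
    0ℚ , (1ℚ , []) ∷ [] , refl ∷ [] , ⊩val [] , sym (Prob-val k V) , ℚ.≤-reflexive (Exp-val k V)
  tightBound k (app V W)   = tightBound-nonVal k (app V W) tt
  tightBound k (M ⊕ N)     = tightBound-nonVal k (M ⊕ N) tt
  tightBound k (letin N M) = tightBound-nonVal k (letin N M) tt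

  tightBound-nonVal : ∀ k M → NonVal M → TightBound k M
  tightBound-nonVal zero M nv = 0ℚ , [] , [] , ⊩zero , sym (Prob-zero-nonVal M nv) , ℚ.≤-refl
  tightBound-nonVal (suc k) M nv with tightBound-components k (liftTerm M) (liftTerm-inUnit M nv)
  ... | b , v , ds , tb , nb , ev with ⊩D-expand M nv ds
  ... | w , d , h =
    w , b , tb , d , trans nb (sym (Prob-suc k M)) ,
    ℚ.≤-trans (ℚ.≤-reflexive (Exp-suc-nonVal k M nv)) (ℚ.≤-trans (ℚ.+-monoʳ-≤ 1ℚ ev) h)

  tightBound-components : ∀ k L → All (InUnit ∘ proj₁) L →
                          Σ TDist λ b → Σ ℚ λ v → ⊩M[ v ] L ∶ b × Tight b ×
                          norm b ≡ expect (Prob k) L × expect (Exp k) L ≤ v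
  tightBound-components k [] [] = [] , 0ℚ , [] , [] , refl , ℚ.≤-refl
  tightBound-components k ((p , N) ∷ L) (p∈ ∷ p∈s) with tightBound k N | tightBound-components k L p∈s
  ... | w , a , ta , d , na , ea | b , v , ds , tb , nb , eb =
    scaleD p a ++ b , p * w + v , d ∷ ds , All.++⁺ (All.map⁺ ta) tb ,
    trans (norm-++ (scaleD p a) b) (cong₂ _+_ (trans (norm-scaleD p a) (cong (p *_) na)) nb) ,
    ℚ.+-mono-≤ (ℚ.*-monoˡ-≤-nonNeg p {{inUnit⇒nonNeg p∈}} ea) eb

mutual
  ≈A-refl : ∀ A → A ≈A A
  ≈A-refl (𝓜 ⇒ a) = ≈⇒ (≈I-refl 𝓜) (≈D-refl a)

  ≈I-refl : ∀ 𝓜 → 𝓜 ≈I 𝓜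
  ≈I-refl [] = []
  ≈I-refl ((q , A) ∷ 𝓜) = cons {ys₁ = []} (≈A-refl A) (≈I-refl 𝓜)

  ≈D-refl : ∀ a → a ≈D a
  ≈D-refl [] = []
  ≈D-refl ((p , 𝓜) ∷ a) = cons {ys₁ = []} (≈I-refl 𝓜) (≈D-refl a)

↭⇒≈I : ∀ (𝓜 : Inter) {𝓝} → 𝓜 ↭ 𝓝 → 𝓜 ≈I 𝓝
↭⇒≈I [] p rewrite ↭.↭-empty-inv (↭-sym p) = []
↭⇒≈I ((q , A) ∷ 𝓜) p with ∈-∃++ (↭.∈-resp-↭ p (here refl))
... | 𝓝₁ , 𝓝₂ , refl = cons (≈A-refl A) (↭⇒≈I 𝓜 (↭.drop-mid [] 𝓝₁ p))

selectAt : ∀ {n} → Fin n → Fin n × (ℚ × Arr) → Maybe (ℚ × Arr)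
selectAt x (y , qA) = if does (x ≟ y) then just qA else nothing

typeAt : ∀ {n} → Fin n → Occ n → Inter
typeAt x = mapMaybe (selectAt x)

toCtx : ∀ {n} → Occ n → Ctx n
toCtx Γ = tabulate (λ x → typeAt x Γ)

lookup-toCtx : ∀ {n} (Γ : Occ n) x → lookup (toCtx Γ) x ≡ typeAt x Γ
lookup-toCtx Γ = Vec.lookup∘tabulate (λ x → typeAt x Γ)

Ctx-ext : ∀ {n} {Γ Δ : Ctx n} → (∀ x → lookup Γ x ≡ lookup Δ x) → Γ ≡ Δ
Ctx-ext {Γ = Γ} {Δ} e =
  trans (sym (Vec.tabulate∘lookup Γ)) (trans (Vec.tabulate-cong e) (Vec.tabulate∘lookup Δ))

typeAt-++ : ∀ {n} (x : Fin n) Γ Δ → typeAt x (Γ ++ Δ) ≡ typeAt x Γ ++ typeAt x Δ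
typeAt-++ x [] Δ = refl
typeAt-++ x ((y , qA) ∷ Γ) Δ with does (x ≟ y)
... | true  = cong (qA ∷_) (typeAt-++ x Γ Δ)
... | false = typeAt-++ x Γ Δ

typeAt-scaleO : ∀ {n} (x : Fin n) u Γ → typeAt x (scaleO u Γ) ≡ scaleI u (typeAt x Γ)
typeAt-scaleO x u [] = refl
typeAt-scaleO x u ((y , qA) ∷ Γ) with does (x ≟ y)
... | true  = cong (_ ∷_) (typeAt-scaleO x u Γ)
... | false = typeAt-scaleO x u Γ

typeAt-single : ∀ {n} (x y : Fin n) 𝓜 → typeAt y (map (x ,_) 𝓜) ≡ (if does (y ≟ x) then 𝓜 else [])
typeAt-single x y [] with does (y ≟ x)
... | true  = refl
... | false = refl
typeAt-single x y (qA ∷ 𝓜) with does (y ≟ x) | typeAt-single x y 𝓜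
... | true  | e = cong (qA ∷_) e
... | false | e = e

typeAt-zero-extendO : ∀ {n} 𝓜 (Γ : Occ n) → typeAt zero (extendO 𝓜 Γ) ≡ 𝓜
typeAt-zero-extendO (qA ∷ 𝓜) Γ = cong (qA ∷_) (typeAt-zero-extendO 𝓜 Γ)
typeAt-zero-extendO [] [] = refl
typeAt-zero-extendO [] (_ ∷ Γ) = typeAt-zero-extendO [] Γ

typeAt-suc-extendO : ∀ {n} x 𝓜 (Γ : Occ n) → typeAt (suc x) (extendO 𝓜 Γ) ≡ typeAt x Γ
typeAt-suc-extendO x (qA ∷ 𝓜) Γ = typeAt-suc-extendO x 𝓜 Γ
typeAt-suc-extendO x [] [] = refl
typeAt-suc-extendO x [] ((y , qA) ∷ Γ) with does (x ≟ y)
... | true  = cong (qA ∷_) (typeAt-suc-extendO x [] Γ)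
... | false = typeAt-suc-extendO x [] Γ

lookup-single : ∀ {n} (x y : Fin n) 𝓜 → lookup (single x 𝓜) y ≡ (if does (y ≟ x) then 𝓜 else [])
lookup-single zero    zero    𝓜 = refl
lookup-single zero    (suc y) 𝓜 = Vec.lookup-replicate y []
lookup-single (suc x) zero    𝓜 = refl
lookup-single {suc n} (suc x) (suc y) 𝓜 = lookup-single {n} x y 𝓜

toCtx-[] : ∀ {n} → toCtx {n} [] ≡ ∅
toCtx-[] = Ctx-ext (λ x → trans (lookup-toCtx [] x) (sym (Vec.lookup-replicate x [])))

toCtx-++ : ∀ {n} (Γ Δ : Occ n) → toCtx (Γ ++ Δ) ≡ toCtx Γ ⊎ toCtx Δ
toCtx-++ Γ Δ = Ctx-ext λ x → begin
  lookup (toCtx (Γ ++ Δ)) x                    ≡⟨ lookup-toCtx (Γ ++ Δ) x ⟩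
  typeAt x (Γ ++ Δ)                            ≡⟨ typeAt-++ x Γ Δ ⟩
  typeAt x Γ ++ typeAt x Δ                     ≡⟨ sym (cong₂ _++_ (lookup-toCtx Γ x) (lookup-toCtx Δ x)) ⟩
  lookup (toCtx Γ) x ++ lookup (toCtx Δ) x     ≡⟨ sym (Vec.lookup-zipWith _++_ x (toCtx Γ) (toCtx Δ)) ⟩
  lookup (toCtx Γ ⊎ toCtx Δ) x                 ∎
  where open ≡-Reasoning

toCtx-scaleO : ∀ {n} u (Γ : Occ n) → toCtx (scaleO u Γ) ≡ u · toCtx Γ
toCtx-scaleO u Γ = Ctx-ext λ x → begin
  lookup (toCtx (scaleO u Γ)) x      ≡⟨ lookup-toCtx (scaleO u Γ) x ⟩
  typeAt x (scaleO u Γ)              ≡⟨ typeAt-scaleO x u Γ ⟩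
  scaleI u (typeAt x Γ)              ≡⟨ cong (scaleI u) (sym (lookup-toCtx Γ x)) ⟩
  scaleI u (lookup (toCtx Γ) x)      ≡⟨ sym (Vec.lookup-map x (scaleI u) (toCtx Γ)) ⟩
  lookup (u · toCtx Γ) x             ∎
  where open ≡-Reasoning

toCtx-single : ∀ {n} (x : Fin n) 𝓜 → toCtx (map (x ,_) 𝓜) ≡ single x 𝓜
toCtx-single x 𝓜 = Ctx-ext λ y →
  trans (lookup-toCtx (map (x ,_) 𝓜) y) (trans (typeAt-single x y 𝓜) (sym (lookup-single x y 𝓜)))

toCtx-extendO : ∀ {n Θ} 𝓜 (Γ : Occ n) → Θ ↭ extendO 𝓜 Γ → toCtx Θ ≈C (𝓜 ∷ toCtx Γ)
toCtx-extendO {Θ = Θ} 𝓜 Γ p = atZero ∷ tabulate⁺ atSuc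
  where
  atZero : typeAt zero Θ ≈I 𝓜
  atZero = ↭⇒≈I _ (subst (typeAt zero Θ ↭_) (typeAt-zero-extendO 𝓜 Γ) (↭.mapMaybe-↭ (selectAt zero) p))
  atSuc : ∀ x → typeAt (suc x) Θ ≈I typeAt x Γ
  atSuc x = ↭⇒≈I _ (subst (typeAt (suc x) Θ ↭_) (typeAt-suc-extendO x 𝓜 Γ)
                           (↭.mapMaybe-↭ (selectAt (suc x)) p))

toCtx-scaleO-++ : ∀ {n} u (Γ Δ : Occ n) → toCtx (scaleO u Γ ++ Δ) ≡ (u · toCtx Γ) ⊎ toCtx Δ
toCtx-scaleO-++ u Γ Δ = trans (toCtx-++ (scaleO u Γ) Δ) (cong (_⊎ toCtx Δ) (toCtx-scaleO u Γ))

⊩I-var-inv : ∀ {n Γ w x 𝓜} → _⊩I[_]_∶_ {n} Γ w (var x) 𝓜 → Γ ≡ map (x ,_) 𝓜 × w ≡ 0ℚ × WFI 𝓜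
⊩I-var-inv [] = refl , refl , []
⊩I-var-inv (⊩var u a ∷ i) with ⊩I-var-inv i
... | refl , refl , wi = refl , ℚ.+-identityˡ 0ℚ , ((u , a) ∷ wi)

record BangPremises {n} (Γ : Occ n) (w : ℚ) (M : Tm (suc n)) (𝓜 : Inter) : Set where
  constructor bang
  field
    m   : ℕ
    q   : Fin m → ℚ
    A   : Fin m → Arr
    Γs  : Fin m → Ctx n
    ws  : Fin m → ℚ
    q∈  : ∀ i → InUnit (q i)
    ⊢A  : ∀ i → Γs i ⊢A[ ws i ] lam M ∶ A i
    Γ≡  : ⨄ (λ i → q i · Γs i) ≡ toCtx Γ
    w≡  : Σℚ (λ i → q i * ws i) ≡ w
    𝓜≡  : tab (λ i → (q i , A i)) ≡ 𝓜

record LetPremises {n} (Δ : Occ n) (w : ℚ) (M : Tm (suc n)) (a b : TDist) : Set where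
  constructor letPremises
  field
    m   : ℕ
    p   : Fin m → ℚ
    𝓜s  : Fin m → Inter
    Δs  : Fin m → Ctx n
    ws  : Fin m → ℚ
    bs  : Fin m → TDist
    ⊢D  : ∀ k → (𝓜s k ∷ Δs k) ⊢D[ ws k ] M ∶ bs k
    Δ≡  : ⨄ (λ k → p k · Δs k) ≡ toCtx Δ
    w≡  : Σℚ (λ k → p k * ws k) ≡ w
    a≡  : tab (λ k → (p k , 𝓜s k)) ≡ a
    b≡  : ⨆ (λ k → scaleD (p k) (bs k)) ≡ b

mutual
  ⊩A⇒⊢A : ∀ {n Γ w M A} → _⊩A[_]λ_∶_ {n} Γ w M A → toCtx Γ ⊢A[ w ] lam M ∶ A
  ⊩A⇒⊢A (⊩λ {Γ = Γ} {𝓜 = 𝓜} _ _ d p) = ⊢λ (convD (toCtx-extendO 𝓜 Γ p) (≈D-refl _) (⊩D⇒⊢D d))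

  ⊩I⇒⊢I : ∀ {n Γ w V 𝓜} → _⊩I[_]_∶_ {n} Γ w V 𝓜 → toCtx Γ ⊢I[ w ] V ∶ 𝓜
  ⊩I⇒⊢I {V = var x} {𝓜 = 𝓜} i with ⊩I-var-inv i
  ... | refl , refl , wi = subst (λ Γ → Γ ⊢I[ 0ℚ ] var x ∶ 𝓜) (sym (toCtx-single x 𝓜)) (⊢var wi)
  ⊩I⇒⊢I {V = lam M} i with ⊩I-lam⇒bangPremises i
  ... | bang m q A Γs ws q∈ ⊢A Γ≡ refl refl = subst (λ Γ → Γ ⊢I[ _ ] lam M ∶ _) Γ≡ (⊢! q A Γs ws q∈ ⊢A)

  ⊩I-lam⇒bangPremises : ∀ {n Γ w M 𝓜} → _⊩I[_]_∶_ {n} Γ w (lam M) 𝓜 → BangPremises Γ w M 𝓜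
  ⊩I-lam⇒bangPremises [] = bang 0 (λ ()) (λ ()) (λ ()) (λ ()) (λ ()) (λ ()) (sym toCtx-[]) refl refl
  ⊩I-lam⇒bangPremises (_∷_ {Δ = Δ} (⊩lam {Γ = Γ₀} {w = w₀} {q = q₀} {A = A₀} u d) i)
    with ⊩I-lam⇒bangPremises i
  ... | bang m q A Γs ws q∈ ⊢A Γ≡ w≡ 𝓜≡ =
    bang (suc m) (q₀ Vector.∷ q) (A₀ Vector.∷ A) (toCtx Γ₀ Vector.∷ Γs) (w₀ Vector.∷ ws)
         (λ { zero → u ; (suc i) → q∈ i }) (λ { zero → ⊩A⇒⊢A d ; (suc i) → ⊢A i })
         (trans (cong ((q₀ · toCtx Γ₀) ⊎_) Γ≡) (sym (toCtx-scaleO-++ q₀ Γ₀ Δ)))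
         (cong (q₀ * w₀ +_) w≡) (cong ((q₀ , A₀) ∷_) 𝓜≡)

  ⊩F⇒letPremises : ∀ {n Δ w M a b} → _⊩F[_]_∶_↦_ {n} Δ w M a b → LetPremises Δ w M a b
  ⊩F⇒letPremises [] =
    letPremises 0 (λ ()) (λ ()) (λ ()) (λ ()) (λ ()) (λ ()) (sym toCtx-[]) refl refl refl
  ⊩F⇒letPremises (cons {Δ = Δ₀} {w = w₀} {b = b₀} {p = p₀} {𝓜 = 𝓜₀} {Δs = Δ} u d q f)
    with ⊩F⇒letPremises f
  ... | letPremises m p 𝓜s Δs ws bs ⊢D Δ≡ w≡ a≡ b≡ =
    letPremises (suc m) (p₀ Vector.∷ p) (𝓜₀ Vector.∷ 𝓜s) (toCtx Δ₀ Vector.∷ Δs) (w₀ Vector.∷ ws)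
      (b₀ Vector.∷ bs)
      (λ { zero → convD (toCtx-extendO 𝓜₀ Δ₀ q) (≈D-refl _) (⊩D⇒⊢D d) ; (suc k) → ⊢D k })
      (trans (cong ((p₀ · toCtx Δ₀) ⊎_) Δ≡) (sym (toCtx-scaleO-++ p₀ Δ₀ Δ)))
      (cong (p₀ * w₀ +_) w≡) (cong ((p₀ , 𝓜₀) ∷_) a≡) (cong (scaleD p₀ b₀ ++_) b≡)

  ⊩D⇒⊢D : ∀ {n Γ w M a} → _⊩D[_]_∶_ {n} Γ w M a → toCtx Γ ⊢D[ w ] M ∶ a
  ⊩D⇒⊢D ⊩zero = subst (λ Γ → Γ ⊢D[ 0ℚ ] _ ∶ []) (sym toCtx-[]) ⊢zero
  ⊩D⇒⊢D (⊩val i) = ⊢val (⊩I⇒⊢I i)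
  ⊩D⇒⊢D (⊩app {Γ = Γ} {Δ = Δ} i j) =
    subst (λ Ξ → Ξ ⊢D[ _ ] _ ∶ _) (sym (toCtx-++ Γ Δ)) (⊢app (⊩I⇒⊢I i) (⊩I⇒⊢I j))
  ⊩D⇒⊢D (⊩⊕ {Γ = Γ} {Δ = Δ} d e) =
    subst (λ Ξ → Ξ ⊢D[ _ ] _ ∶ _)
          (sym (trans (toCtx-++ (scaleO ½ Γ) (scaleO ½ Δ))
                      (cong₂ _⊎_ (toCtx-scaleO ½ Γ) (toCtx-scaleO ½ Δ))))
          (⊢⊕ (⊩D⇒⊢D d) (⊩D⇒⊢D e))
  ⊩D⇒⊢D (⊩let {Γ = Γ} {Δ = Δ} d f) with ⊩F⇒letPremises f
  ... | letPremises m p 𝓜s Δs ws bs ⊢D Δ≡ refl refl refl =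
    subst (λ Ξ → Ξ ⊢D[ _ ] _ ∶ _) (trans (cong (toCtx Γ ⊎_) Δ≡) (sym (toCtx-++ Γ Δ)))
          (⊢let p 𝓜s Δs ws bs (⊩D⇒⊢D d) ⊢D)

mainTheorem10 : (M : Tm 0) (k : ℕ) →
    Σ ℚ (λ w → Σ TDist (λ a →
    Tight a × (∅ ⊢D[ w ] M ∶ a) × (norm a ≡ Prob k M) × (Exp k M ≤ w)))
mainTheorem10 M k with tightBound k M
... | w , a , tight , ⊩M , norm≡ , Exp≤ =
  w , a , tight , subst (λ Γ → Γ ⊢D[ w ] M ∶ a) toCtx-[] (⊩D⇒⊢D ⊩M) , norm≡ , Exp≤
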